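{- Let $k$ and $s$ be natural numbers. Every graph containing a $(k+2)$-rake as a (not necessarily induced) subgraph contains either an $(s+5)$-dense $k$-rake as a subgraph or a canonical graph of order at least $s$ as an induced subgraph.
   Context: All graphs are finite, simple, undirected. A rake consists of a path (the base) together with pendant vertices (teeth), each tooth adjacent to exactly one vertex of the base (its root), distinct teeth having distinct roots; a $k$-rake has $k$ teeth. A rake is $\ell$-dense if any $\ell$ consecutive vertices of the base contain at least one root. For $i\ge 1$, $H_i$ is the graph obtained from a path $u_0\cdots u_i$ by attaching two pendant vertices to $u_0$ and two to $u_i$; $H'_i$ is obtained from $H_i$ by joining the two pendant vertices at one end, and $H''_i$ by joining both such pairs. An $H$-graph is any $H_i$, $H'_i$ or $H''_i$, with body the path $u_0\cdots u_i$. A hole is a chordless cycle of length at least four. A canonical graph is a hole or an $H$-graph; its order is its number of vertices for a hole, and the number of vertices of its body for an $H$-graph. -}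

module Defs where

open import Data.Nat using (ℕ; zero; suc; _+_; _≤_; _<_; _≡ᵇ_; _<ᵇ_)
open import Data.Bool using (Bool; true; false; _∧_; _∨_; not; if_then_else_)
open import Data.Fin using (Fin; toℕ; splitAt)
open import Data.Fin.Properties using (_≟_)
open import Data.Sum using (_⊎_; inj₁; inj₂)
open import Data.Product using (∃; _×_; Σ)
open import Relation.Binary.PropositionalEquality using (_≡_)
open import Relation.Nullary.Decidable using (⌊_⌋)
open import Function.Definitions using (Injective)

record Graph : Set where
  field
    n          : ℕ
    adj        : Fin n → Fin n → Bool
    adj-sym    : ∀ x y → adj x y ≡ adj y x
    adj-irrefl : ∀ x → adj x x ≡ false
open Graph public

-- Pattern graphs are given by an (evidently symmetric, loopless) adjacency
-- function on Fin p.

SubgraphOf : {p : ℕ} → (Fin p → Fin p → Bool) → Graph → Set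
SubgraphOf {p} P G =
  Σ (Fin p → Fin (n G)) λ f →
    Injective _≡_ _≡_ f × (∀ x y → P x y ≡ true → adj G (f x) (f y) ≡ true)

InducedSubgraphOf : {p : ℕ} → (Fin p → Fin p → Bool) → Graph → Set
InducedSubgraphOf {p} P G =
  Σ (Fin p → Fin (n G)) λ f →
    Injective _≡_ _≡_ f × (∀ x y → adj G (f x) (f y) ≡ P x y)

pathAdj : {m : ℕ} → Fin m → Fin m → Bool
pathAdj a b = (suc (toℕ a) ≡ᵇ toℕ b) ∨ (suc (toℕ b) ≡ᵇ toℕ a)

record Rake (k : ℕ) : Set where
  field
    m        : ℕ
    root     : Fin k → Fin (suc m)
    root-inj : Injective _≡_ _≡_ root
open Rake public

-- vertices: Fin (suc m + k); the first (suc m) form the base, the rest are teeth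
rakeAdj : {k : ℕ} (R : Rake k) → Fin (suc (m R) + k) → Fin (suc (m R) + k) → Bool
rakeAdj {k} R x y = go (splitAt (suc (m R)) x) (splitAt (suc (m R)) y)
  where
  go : Fin (suc (m R)) ⊎ Fin k → Fin (suc (m R)) ⊎ Fin k → Bool
  go (inj₁ a) (inj₁ b) = pathAdj a b
  go (inj₁ a) (inj₂ t) = ⌊ root R t ≟ a ⌋
  go (inj₂ t) (inj₁ a) = ⌊ root R t ≟ a ⌋
  go (inj₂ _) (inj₂ _) = false

Dense : {k : ℕ} → ℕ → Rake k → Set
Dense {k} ℓ R =
  ∀ (i : ℕ) → i + ℓ ≤ suc (m R) →
    ∃ λ (t : Fin k) → i ≤ toℕ (root R t) × toℕ (root R t) < i + ℓ

cycSucc : {L : ℕ} → Fin L → Fin L → Bool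
cycSucc {L} a b = (suc (toℕ a) ≡ᵇ toℕ b) ∨ ((suc (toℕ a) ≡ᵇ L) ∧ (toℕ b ≡ᵇ 0))

cycleAdj : (L : ℕ) → Fin L → Fin L → Bool
cycleAdj L a b = cycSucc a b ∨ cycSucc b a

data HVariant : Set where
  plain  : HVariant
  single : HVariant   -- H'_i  (the two pendant vertices at u_0 joined)
  double : HVariant   -- H''_i (both pairs joined)

joinedFirst : HVariant → Bool
joinedFirst plain  = false
joinedFirst single = true
joinedFirst double = true

joinedSecond : HVariant → Bool
joinedSecond plain  = false
joinedSecond single = false
joinedSecond double = true

-- the four pendant vertices: 0,1 attached at u_0 and 2,3 attached at u_i
extraAdj : HVariant → Fin 4 → Fin 4 → Bool
extraAdj v Fin.zero (Fin.suc Fin.zero) = joinedFirst v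
extraAdj v (Fin.suc Fin.zero) Fin.zero = joinedFirst v
extraAdj v (Fin.suc (Fin.suc Fin.zero)) (Fin.suc (Fin.suc (Fin.suc Fin.zero))) = joinedSecond v
extraAdj v (Fin.suc (Fin.suc (Fin.suc Fin.zero))) (Fin.suc (Fin.suc Fin.zero)) = joinedSecond v
extraAdj v _ _ = false

attached : (i : ℕ) → Fin (suc i) → Fin 4 → Bool
attached i p e = if toℕ e <ᵇ 2 then toℕ p ≡ᵇ 0 else toℕ p ≡ᵇ i

-- vertices: Fin (suc i + 4); first (suc i) are the body u_0 ... u_i
hAdj : HVariant → (i : ℕ) → Fin (suc i + 4) → Fin (suc i + 4) → Bool
hAdj v i x y = go (splitAt (suc i) x) (splitAt (suc i) y)
  where
  go : Fin (suc i) ⊎ Fin 4 → Fin (suc i) ⊎ Fin 4 → Bool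
  go (inj₁ a) (inj₁ b) = pathAdj a b
  go (inj₁ a) (inj₂ e) = attached i a e
  go (inj₂ e) (inj₁ a) = attached i a e
  go (inj₂ e) (inj₂ e') = extraAdj v e e'

-- G contains a canonical graph of order at least s as an induced subgraph:
-- a hole of length L ≥ 4 with L ≥ s, or an H-graph whose body u_0 … u_i
-- (i ≥ 1) has i+1 ≥ s vertices.
HasCanonicalInduced : ℕ → Graph → Set
HasCanonicalInduced s G =
  (∃ λ (L : ℕ) → 4 ≤ L × s ≤ L × InducedSubgraphOf (cycleAdj L) G)
  ⊎ (∃ λ (v : HVariant) → ∃ λ (i : ℕ) → 1 ≤ i × s ≤ suc i × InducedSubgraphOf (hAdj v i) G)

-- Induction on the length of the base of an embedded (k+2)-rake. Discarding the two teeth with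
-- extreme roots leaves a k-rake on the base segment between the remaining extreme roots; either it
-- is (s+5)-dense, or two consecutive roots x < y are more than s+5 apart, both strictly inside the
-- base. In the second case consider the base segment from x to y, the teeth T₁, T₂ at x and y, and
-- the base neighbours L₁, R₁ just outside the segment. A chord of the segment, or an edge from one
-- of T₁, T₂, L₁, R₁ to the segment away from its near end, is a shortcut: it yields an embedded
-- (k+2)-rake with a shorter base. Without shortcuts the segment is an induced path, and the edges
-- among T₁, T₂, L₁, R₁ and the neighbours of T₁, T₂ at the ends of the path produce either a hole
-- or an H-graph, whose order exceeds s because the segment is long.
module Submission where

open import Defs
open import Data.Nat
open import Data.Nat.Properties
open import Data.Nat.Tactic.RingSolver using (solve-∀)
open import Data.Bool using (Bool; true; false; _∧_; _∨_; T)
open import Data.Bool.Properties using (¬-not) renaming (_≟_ to _≟ᵇ_)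
open import Data.Fin as F using (Fin; toℕ; splitAt; join; fromℕ<; _↑ˡ_; _↑ʳ_; punchIn; punchOut)
import Data.Fin.Properties as FP
open import Data.Sum using (_⊎_; inj₁; inj₂; [_,_]′)
open import Data.Product using (∃; _×_; Σ; _,_; proj₁; proj₂)
open import Data.Empty using (⊥; ⊥-elim)
open import Data.Unit using (tt)
open import Relation.Nullary using (¬_; Dec; yes; no)
open import Relation.Nullary.Decidable as D using (⌊_⌋; decidable-stable)
open import Relation.Binary.PropositionalEquality
open import Relation.Binary.Definitions using (tri<; tri≈; tri>)
open import Function.Definitions using (Injective)
open import Induction.WellFounded using (Acc; acc)
open import Data.Nat.Induction using (<-wellFounded)

≡true-ext : {x y : Bool} → (x ≡ true → y ≡ true) → (y ≡ true → x ≡ true) → x ≡ y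
≡true-ext {false} {false} f g = refl
≡true-ext {false} {true}  f g = g refl
≡true-ext {true}  {false} f g = sym (f refl)
≡true-ext {true}  {true}  f g = refl

∨-true⁻ : {x y : Bool} → x ∨ y ≡ true → x ≡ true ⊎ y ≡ true
∨-true⁻ {true}  e = inj₁ refl
∨-true⁻ {false} e = inj₂ e

∨-trueˡ : {x y : Bool} → x ≡ true → x ∨ y ≡ true
∨-trueˡ refl = refl

∨-trueʳ : {x y : Bool} → y ≡ true → x ∨ y ≡ true
∨-trueʳ {true}  e = refl
∨-trueʳ {false} e = e

∧-true⁻ : {x y : Bool} → x ∧ y ≡ true → x ≡ true × y ≡ true
∧-true⁻ {true} {true} e = refl , refl

∧-true : {x y : Bool} → x ≡ true → y ≡ true → x ∧ y ≡ true
∧-true refl refl = refl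

≢true⇒≡false : {x : Bool} → x ≢ true → x ≡ false
≢true⇒≡false = ¬-not

≡ᵇ-true⁻ : ∀ {m n} → (m ≡ᵇ n) ≡ true → m ≡ n
≡ᵇ-true⁻ {m} {n} e = ≡ᵇ⇒≡ m n (subst T (sym e) tt)

≡ᵇ-true : ∀ {m n} → m ≡ n → (m ≡ᵇ n) ≡ true
≡ᵇ-true {zero}  refl = refl
≡ᵇ-true {suc m} refl = ≡ᵇ-true {m} refl

≡ᵇ-false : ∀ {m n} → m ≢ n → (m ≡ᵇ n) ≡ false
≡ᵇ-false m≢n = ≢true⇒≡false (λ e → m≢n (≡ᵇ-true⁻ e))

pathAdjℕ : ℕ → ℕ → Bool
pathAdjℕ i j = (suc i ≡ᵇ j) ∨ (suc j ≡ᵇ i)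

Consecutive : ℕ → ℕ → Set
Consecutive i j = suc i ≡ j ⊎ suc j ≡ i

pathAdjℕ-true⁻ : ∀ i j → pathAdjℕ i j ≡ true → Consecutive i j
pathAdjℕ-true⁻ i j e with ∨-true⁻ e
... | inj₁ i+1≡j = inj₁ (≡ᵇ-true⁻ i+1≡j)
... | inj₂ j+1≡i = inj₂ (≡ᵇ-true⁻ j+1≡i)

pathAdjℕ-true : ∀ i j → Consecutive i j → pathAdjℕ i j ≡ true
pathAdjℕ-true i j (inj₁ i+1≡j) = ∨-trueˡ (≡ᵇ-true i+1≡j)
pathAdjℕ-true i j (inj₂ j+1≡i) = ∨-trueʳ {suc i ≡ᵇ j} (≡ᵇ-true j+1≡i)

pathAdjℕ-suc : ∀ i → pathAdjℕ i (suc i) ≡ true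
pathAdjℕ-suc i = pathAdjℕ-true i (suc i) (inj₁ refl)

pathAdjℕ-sym : ∀ i j → pathAdjℕ i j ≡ pathAdjℕ j i
pathAdjℕ-sym i j = ≡true-ext (λ e → pathAdjℕ-true j i (swap (pathAdjℕ-true⁻ i j e)))
                             (λ e → pathAdjℕ-true i j (swap (pathAdjℕ-true⁻ j i e)))
  where
  swap : ∀ {i j} → Consecutive i j → Consecutive j i
  swap (inj₁ e) = inj₂ e
  swap (inj₂ e) = inj₁ e

pathAdjℕ-+ˡ : ∀ a i j → pathAdjℕ (a + i) (a + j) ≡ pathAdjℕ i j
pathAdjℕ-+ˡ zero    i j = refl
pathAdjℕ-+ˡ (suc a) i j = pathAdjℕ-+ˡ a i j

pathAdjℕ-far : ∀ {i j} → suc i < j → pathAdjℕ i j ≡ false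
pathAdjℕ-far {i} {j} i+1<j = ≢true⇒≡false (λ e → [ <⇒≢ i+1<j , j+1≢i ]′ (pathAdjℕ-true⁻ i j e))
  where
  j+1≢i : suc j ≢ i
  j+1≢i refl = <-asym (n<1+n j) (<-trans (n<1+n (suc j)) i+1<j)

pathAdjℕ-irrefl : ∀ i → pathAdjℕ i i ≡ false
pathAdjℕ-irrefl i = ≢true⇒≡false (λ e → [ i+1≢i , i+1≢i ]′ (pathAdjℕ-true⁻ i i e))
  where
  i+1≢i : suc i ≢ i
  i+1≢i e = <⇒≢ (n<1+n i) (sym e)

pathAdjℕ-reflect : ∀ L i j → i ≤ L → j ≤ L → pathAdjℕ (L ∸ i) (L ∸ j) ≡ pathAdjℕ i j
pathAdjℕ-reflect L i j i≤L j≤L = ≡true-ext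
  (λ e → pathAdjℕ-true i j (reflect⁻ (pathAdjℕ-true⁻ (L ∸ i) (L ∸ j) e)))
  (λ e → pathAdjℕ-true (L ∸ i) (L ∸ j) (reflect (pathAdjℕ-true⁻ i j e)))
  where
  open ≡-Reasoning
  step⁻ : ∀ {i j} → i ≤ L → j ≤ L → suc (L ∸ i) ≡ L ∸ j → suc j ≡ i
  step⁻ {i} {j} i≤L j≤L e = +-cancelˡ-≡ (L ∸ i) (suc j) i (begin
      (L ∸ i) + suc j   ≡⟨ +-suc (L ∸ i) j ⟩
      suc (L ∸ i) + j   ≡⟨ cong (_+ j) e ⟩
      (L ∸ j) + j       ≡⟨ m∸n+n≡m j≤L ⟩
      L                 ≡⟨ m∸n+n≡m i≤L ⟨
      (L ∸ i) + i       ∎)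
  step : ∀ {i j} → i ≤ L → j ≤ L → suc j ≡ i → suc (L ∸ i) ≡ L ∸ j
  step {i} {j} i≤L j≤L e = +-cancelʳ-≡ j (suc (L ∸ i)) (L ∸ j) (begin
      suc (L ∸ i) + j   ≡⟨ +-suc (L ∸ i) j ⟨
      (L ∸ i) + suc j   ≡⟨ cong ((L ∸ i) +_) e ⟩
      (L ∸ i) + i       ≡⟨ m∸n+n≡m i≤L ⟩
      L                 ≡⟨ m∸n+n≡m j≤L ⟨
      (L ∸ j) + j       ∎)
  reflect⁻ : Consecutive (L ∸ i) (L ∸ j) → Consecutive i j
  reflect⁻ (inj₁ e) = inj₂ (step⁻ i≤L j≤L e)
  reflect⁻ (inj₂ e) = inj₁ (step⁻ j≤L i≤L e)
  reflect : Consecutive i j → Consecutive (L ∸ i) (L ∸ j)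
  reflect (inj₁ e) = inj₂ (step j≤L i≤L e)
  reflect (inj₂ e) = inj₁ (step i≤L j≤L e)

∸≡ᵇ-self : ∀ L j → j ≤ L → ((L ∸ j) ≡ᵇ L) ≡ (j ≡ᵇ 0)
∸≡ᵇ-self L zero    _   = ≡ᵇ-true {L} refl
∸≡ᵇ-self L (suc j) j<L = ≡ᵇ-false (λ e → <⇒≢ (∸-monoʳ-< {L} z<s j<L) e)

∸≡ᵇ-zero : ∀ L j → j ≤ L → ((L ∸ j) ≡ᵇ 0) ≡ (j ≡ᵇ L)
∸≡ᵇ-zero L j j≤L = ≡true-ext
  (λ e → ≡ᵇ-true (≤-antisym j≤L (m∸n≡0⇒m≤n (≡ᵇ-true⁻ {L ∸ j} e))))
  (λ e → ≡ᵇ-true {L ∸ j} (trans (cong (L ∸_) (≡ᵇ-true⁻ {j} e)) (n∸n≡0 L)))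

only-at-ends : ∀ L (f : ℕ → Bool) → f 0 ≡ true → f L ≡ true → (∀ j → 1 ≤ j → suc j ≤ L → f j ≡ false)
  → ∀ j → j ≤ L → f j ≡ ((j ≡ᵇ 0) ∨ (j ≡ᵇ L))
only-at-ends L f f0 fL inner zero    _ = f0
only-at-ends L f f0 fL inner (suc j) j≤L with m≤n⇒m<n∨m≡n j≤L
... | inj₁ j<L = trans (inner (suc j) (s≤s z≤n) j<L) (sym (≡ᵇ-false (<⇒≢ j<L)))
... | inj₂ refl = trans fL (sym (≡ᵇ-true {suc j} refl))

only-at-first : ∀ L (f : ℕ → Bool) → f 0 ≡ true → (∀ j → 1 ≤ j → j ≤ L → f j ≡ false)
  → ∀ j → j ≤ L → f j ≡ (j ≡ᵇ 0)
only-at-first L f f0 rest zero    _   = f0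
only-at-first L f f0 rest (suc j) j≤L = rest (suc j) (s≤s z≤n) j≤L

only-at-last : ∀ L (f : ℕ → Bool) → f L ≡ true → (∀ j → j < L → f j ≡ false)
  → ∀ j → j ≤ L → f j ≡ (j ≡ᵇ L)
only-at-last L f fL rest j j≤L with m≤n⇒m<n∨m≡n j≤L
... | inj₁ j<L = trans (rest j j<L) (sym (≡ᵇ-false (<⇒≢ j<L)))
... | inj₂ refl = trans fL (sym (≡ᵇ-true {j} refl))

search< : (N : ℕ) (P : ℕ → Set) → (∀ i → Dec (P i)) → (∃ λ i → i < N × P i) ⊎ (∀ i → i < N → ¬ P i)
search< zero    P P? = inj₂ (λ i ())
search< (suc N) P P? with search< N P P?
... | inj₁ (i , i<N , p) = inj₁ (i , m<n⇒m<1+n i<N , p)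
... | inj₂ none with P? N
...   | yes p = inj₁ (N , ≤-refl , p)
...   | no ¬p = inj₂ (λ i i<N+1 → below (m≤n⇒m<n∨m≡n (≤-pred i<N+1)))
  where
  below : ∀ {i} → i < N ⊎ i ≡ N → ¬ P i
  below (inj₁ i<N) = none _ i<N
  below (inj₂ refl) = ¬p

greatestBelow : (N : ℕ) (P : ℕ → Set) → (∀ i → Dec (P i)) → (∃ λ j → j < N × P j)
  → ∃ λ x → x < N × P x × (∀ j → x < j → j < N → ¬ P j)
greatestBelow zero    P P? (j , () , _)
greatestBelow (suc N) P P? (j , j<N+1 , p) with P? N
... | yes q = N , ≤-refl , q , (λ j N<j j<N+1 → ⊥-elim (<-irrefl refl (≤-trans N<j (≤-pred j<N+1))))
... | no ¬q with m≤n⇒m<n∨m≡n (≤-pred j<N+1)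
...   | inj₂ refl = ⊥-elim (¬q p)
...   | inj₁ j<N with greatestBelow N P P? (j , j<N , p)
...     | x , x<N , px , above = x , m<n⇒m<1+n x<N , px , above′
  where
  above′ : ∀ j → x < j → j < suc N → ¬ P j
  above′ j x<j j<N+1 with m≤n⇒m<n∨m≡n (≤-pred j<N+1)
  ... | inj₁ j<N = above j x<j j<N
  ... | inj₂ refl = ¬q

leastFrom : (N D : ℕ) (P : ℕ → Set) → (∀ i → Dec (P i)) → P (N + D)
  → ∃ λ y → N ≤ y × y ≤ N + D × P y × (∀ j → N ≤ j → j < y → ¬ P j)
leastFrom N D P P? p with P? N
... | yes q = N , ≤-refl , m≤m+n N D , q , (λ j N≤j j<N → ⊥-elim (<-irrefl refl (≤-trans j<N N≤j)))
leastFrom N zero    P P? p | no ¬q = ⊥-elim (¬q (subst P (+-identityʳ N) p))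
leastFrom N (suc D) P P? p | no ¬q with leastFrom (suc N) D P P? (subst P (+-suc N D) p)
... | y , N<y , y≤ , py , below = y , <⇒≤ N<y , subst (y ≤_) (sym (+-suc N D)) y≤ , py , below′
  where
  below′ : ∀ j → N ≤ j → j < y → ¬ P j
  below′ j N≤j j<y with m≤n⇒m<n∨m≡n N≤j
  ... | inj₁ N<j = below j N<j j<y
  ... | inj₂ refl = ¬q

argmin : ∀ {n} (f : Fin (suc n) → ℕ) → Σ (Fin (suc n)) λ t → ∀ u → f t ≤ f u
argmin {zero}  f = F.zero , λ { F.zero → ≤-refl }
argmin {suc n} f with argmin (λ u → f (F.suc u))
... | t , min with f F.zero ≤? f (F.suc t)
...   | yes p = F.zero , λ { F.zero → ≤-refl ; (F.suc u) → ≤-trans p (min u) }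
...   | no ¬p = F.suc t , λ { F.zero → <⇒≤ (≰⇒> ¬p) ; (F.suc u) → min u }

argmax : ∀ {n} (f : Fin (suc n) → ℕ) → Σ (Fin (suc n)) λ t → ∀ u → f u ≤ f t
argmax {zero}  f = F.zero , λ { F.zero → ≤-refl }
argmax {suc n} f with argmax (λ u → f (F.suc u))
... | t , max with f (F.suc t) ≤? f F.zero
...   | yes p = F.zero , λ { F.zero → ≤-refl ; (F.suc u) → ≤-trans (max u) p }
...   | no ¬p = F.suc t , λ { F.zero → <⇒≤ (≰⇒> ¬p) ; (F.suc u) → max u }

argminFrom : ∀ {n} → Fin n → (f : Fin n → ℕ) → Σ (Fin n) λ t → ∀ u → f t ≤ f u
argminFrom {suc n} _ f = argmin f

argmaxFrom : ∀ {n} → Fin n → (f : Fin n → ℕ) → Σ (Fin n) λ t → ∀ u → f u ≤ f t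
argmaxFrom {suc n} _ f = argmax f

data Region (a i : ℕ) : Set where
  prefix : i ≤ a → Region a i
  middle : i ≡ suc a → Region a i
  suffix : suc (suc a) ≤ i → Region a i

region : ∀ a i → Region a i
region a i with i ≤? a
... | yes h = prefix h
... | no h with ≰⇒> h
... | q with m≤n⇒m<n∨m≡n q
... | inj₁ r = suffix r
... | inj₂ r = middle (sym r)

splitAt-injective : ∀ p {q} (x y : Fin (p + q)) → splitAt p x ≡ splitAt p y → x ≡ y
splitAt-injective p {q} x y e = begin
  x                    ≡⟨ FP.join-splitAt p q x ⟨
  join p q (splitAt p x) ≡⟨ cong (join p q) e ⟩
  join p q (splitAt p y) ≡⟨ FP.join-splitAt p q y ⟩
  y                    ∎
  where open ≡-Reasoning

toℕ≤pred : ∀ {i} (a : Fin (suc i)) → toℕ a ≤ i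
toℕ≤pred a = ≤-pred (FP.toℕ<n a)

CycleConsecutive : ℕ → ℕ → ℕ → Set
CycleConsecutive L i j = (suc i ≡ j ⊎ (suc i ≡ L × j ≡ 0)) ⊎ (suc j ≡ i ⊎ (suc j ≡ L × i ≡ 0))

CycleConsecutive-sym : ∀ {L i j} → CycleConsecutive L i j → CycleConsecutive L j i
CycleConsecutive-sym (inj₁ e) = inj₂ e
CycleConsecutive-sym (inj₂ e) = inj₁ e

cycSucc-true⁻ : ∀ {L} (a b : Fin L) → cycSucc a b ≡ true → suc (toℕ a) ≡ toℕ b ⊎ (suc (toℕ a) ≡ L × toℕ b ≡ 0)
cycSucc-true⁻ a b e with ∨-true⁻ e
... | inj₁ next = inj₁ (≡ᵇ-true⁻ next)
... | inj₂ wrap with ∧-true⁻ wrap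
...   | last , first = inj₂ (≡ᵇ-true⁻ last , ≡ᵇ-true⁻ first)

cycSucc-true : ∀ {L} (a b : Fin L) → suc (toℕ a) ≡ toℕ b ⊎ (suc (toℕ a) ≡ L × toℕ b ≡ 0) → cycSucc a b ≡ true
cycSucc-true a b (inj₁ next) = ∨-trueˡ (≡ᵇ-true next)
cycSucc-true a b (inj₂ (last , first)) = ∨-trueʳ {suc (toℕ a) ≡ᵇ toℕ b} (∧-true (≡ᵇ-true last) (≡ᵇ-true first))

cycleAdj-true⁻ : ∀ {L} (a b : Fin L) → cycleAdj L a b ≡ true → CycleConsecutive L (toℕ a) (toℕ b)
cycleAdj-true⁻ a b e with ∨-true⁻ e
... | inj₁ ab = inj₁ (cycSucc-true⁻ a b ab)
... | inj₂ ba = inj₂ (cycSucc-true⁻ b a ba)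

cycleAdj-true : ∀ {L} (a b : Fin L) → CycleConsecutive L (toℕ a) (toℕ b) → cycleAdj L a b ≡ true
cycleAdj-true a b (inj₁ ab) = ∨-trueˡ (cycSucc-true a b ab)
cycleAdj-true a b (inj₂ ba) = ∨-trueʳ {cycSucc a b} (cycSucc-true b a ba)

hAdj′ : HVariant → (i : ℕ) → Fin (suc i) ⊎ Fin 4 → Fin (suc i) ⊎ Fin 4 → Bool
hAdj′ v i (inj₁ a) (inj₁ b) = pathAdj a b
hAdj′ v i (inj₁ a) (inj₂ e) = attached i a e
hAdj′ v i (inj₂ e) (inj₁ a) = attached i a e
hAdj′ v i (inj₂ e) (inj₂ e′) = extraAdj v e e′

hAdj-splitAt : ∀ v i x y → hAdj v i x y ≡ hAdj′ v i (splitAt (suc i) x) (splitAt (suc i) y)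
hAdj-splitAt v i x y with splitAt (suc i) x | splitAt (suc i) y
... | inj₁ a | inj₁ b = refl
... | inj₁ a | inj₂ b = refl
... | inj₂ a | inj₁ b = refl
... | inj₂ a | inj₂ b = refl

rakeAdj′ : ∀ {K} (R : Rake K) → Fin (suc (m R)) ⊎ Fin K → Fin (suc (m R)) ⊎ Fin K → Bool
rakeAdj′ R (inj₁ a) (inj₁ b) = pathAdj a b
rakeAdj′ R (inj₁ a) (inj₂ t) = ⌊ root R t FP.≟ a ⌋
rakeAdj′ R (inj₂ t) (inj₁ a) = ⌊ root R t FP.≟ a ⌋
rakeAdj′ R (inj₂ _) (inj₂ _) = false

rakeAdj-splitAt : ∀ {K} (R : Rake K) x y → rakeAdj R x y ≡ rakeAdj′ R (splitAt (suc (m R)) x) (splitAt (suc (m R)) y)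
rakeAdj-splitAt R x y with splitAt (suc (m R)) x | splitAt (suc (m R)) y
... | inj₁ a | inj₁ b = refl
... | inj₁ a | inj₂ b = refl
... | inj₂ a | inj₁ b = refl
... | inj₂ a | inj₂ b = refl

module _ (G : Graph) where

  V : Set
  V = Fin (n G)

  A : V → V → Bool
  A = adj G

  A-sym : ∀ x y → A x y ≡ A y x
  A-sym = adj-sym G

  A-irrefl : ∀ x → A x x ≡ false
  A-irrefl = adj-irrefl G

  record InducedPath (L : ℕ) : Set where
    field
      vertex     : ℕ → V
      vertex-inj : ∀ i j → i ≤ L → j ≤ L → vertex i ≡ vertex j → i ≡ j
      vertex-adj : ∀ i j → i ≤ L → j ≤ L → A (vertex i) (vertex j) ≡ pathAdjℕ i j
  open InducedPath public

  prepend : ∀ {L} (P : InducedPath L) (w : V) → (∀ j → j ≤ L → w ≢ vertex P j)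
          → (∀ j → j ≤ L → A w (vertex P j) ≡ (j ≡ᵇ 0)) → InducedPath (suc L)
  prepend {L} P w w∉P w-adj = record { vertex = q ; vertex-inj = q-inj ; vertex-adj = q-adj }
    where
    q : ℕ → V
    q zero    = w
    q (suc j) = vertex P j
    q-inj : ∀ i j → i ≤ suc L → j ≤ suc L → q i ≡ q j → i ≡ j
    q-inj zero    zero    _ _ _ = refl
    q-inj zero    (suc j) _ (s≤s j≤L) e = ⊥-elim (w∉P j j≤L e)
    q-inj (suc i) zero    (s≤s i≤L) _ e = ⊥-elim (w∉P i i≤L (sym e))
    q-inj (suc i) (suc j) (s≤s i≤L) (s≤s j≤L) e = cong suc (vertex-inj P i j i≤L j≤L e)
    first : ∀ j → (j ≡ᵇ 0) ≡ pathAdjℕ 0 (suc j)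
    first zero    = refl
    first (suc j) = refl
    q-adj : ∀ i j → i ≤ suc L → j ≤ suc L → A (q i) (q j) ≡ pathAdjℕ i j
    q-adj zero    zero    _ _ = A-irrefl w
    q-adj zero    (suc j) _ (s≤s j≤L) = trans (w-adj j j≤L) (first j)
    q-adj (suc i) zero    (s≤s i≤L) _ =
      trans (A-sym _ _) (trans (w-adj i i≤L) (trans (first i) (pathAdjℕ-sym 0 (suc i))))
    q-adj (suc i) (suc j) (s≤s i≤L) (s≤s j≤L) = vertex-adj P i j i≤L j≤L

  reverse : ∀ {L} → InducedPath L → InducedPath L
  reverse {L} P = record { vertex = λ j → vertex P (L ∸ j) ; vertex-inj = r-inj ; vertex-adj = r-adj }
    where
    r-inj : ∀ i j → i ≤ L → j ≤ L → vertex P (L ∸ i) ≡ vertex P (L ∸ j) → i ≡ j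
    r-inj i j i≤L j≤L e = ∸-cancelˡ-≡ i≤L j≤L (vertex-inj P (L ∸ i) (L ∸ j) (m∸n≤m L i) (m∸n≤m L j) e)
    r-adj : ∀ i j → i ≤ L → j ≤ L → A (vertex P (L ∸ i)) (vertex P (L ∸ j)) ≡ pathAdjℕ i j
    r-adj i j i≤L j≤L = trans (vertex-adj P (L ∸ i) (L ∸ j) (m∸n≤m L i) (m∸n≤m L j)) (pathAdjℕ-reflect L i j i≤L j≤L)

  module CloseHole {L : ℕ} (P : InducedPath L) (v : V)
    (v∉P : ∀ j → j ≤ L → v ≢ vertex P j)
    (v-adj : ∀ j → j ≤ L → A v (vertex P j) ≡ ((j ≡ᵇ 0) ∨ (j ≡ᵇ L))) where

    cycleVertex : ℕ → V
    cycleVertex j with j ≤? L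
    ... | yes _ = vertex P j
    ... | no _  = v

    cycleVertex-path : ∀ {j} → j ≤ L → cycleVertex j ≡ vertex P j
    cycleVertex-path {j} j≤L with j ≤? L
    ... | yes _ = refl
    ... | no j≰L = ⊥-elim (j≰L j≤L)

    cycleVertex-apex : cycleVertex (suc L) ≡ v
    cycleVertex-apex with suc L ≤? L
    ... | yes L<L = ⊥-elim (<-irrefl refl L<L)
    ... | no _ = refl

    data Position (j : ℕ) : Set where
      onPath : j ≤ L → Position j
      apex   : j ≡ suc L → Position j

    position : ∀ j → j < suc (suc L) → Position j
    position j (s≤s j≤L+1) with m≤n⇒m<n∨m≡n j≤L+1
    ... | inj₁ (s≤s j≤L) = onPath j≤L
    ... | inj₂ j≡L+1 = apex j≡L+1

    Adj⇔ : ℕ → ℕ → Set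
    Adj⇔ i j = (A (cycleVertex i) (cycleVertex j) ≡ true → CycleConsecutive (suc (suc L)) i j)
             × (CycleConsecutive (suc (suc L)) i j → A (cycleVertex i) (cycleVertex j) ≡ true)

    apex-adj⇔ : ∀ j → j ≤ L → (A v (vertex P j) ≡ true → CycleConsecutive (suc (suc L)) (suc L) j)
                            × (CycleConsecutive (suc (suc L)) (suc L) j → A v (vertex P j) ≡ true)
    apex-adj⇔ j j≤L = to , from
      where
      to : A v (vertex P j) ≡ true → CycleConsecutive (suc (suc L)) (suc L) j
      to e with ∨-true⁻ (trans (sym (v-adj j j≤L)) e)
      ... | inj₁ j≡0 = inj₁ (inj₂ (refl , ≡ᵇ-true⁻ j≡0))
      ... | inj₂ j≡L = inj₂ (inj₁ (cong suc (≡ᵇ-true⁻ j≡L)))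
      from : CycleConsecutive (suc (suc L)) (suc L) j → A v (vertex P j) ≡ true
      from (inj₁ (inj₁ L+2≡j)) = ⊥-elim (<-irrefl (sym L+2≡j) (s≤s (≤-trans j≤L (n≤1+n L))))
      from (inj₁ (inj₂ (_ , j≡0))) = trans (v-adj j j≤L) (∨-trueˡ (≡ᵇ-true j≡0))
      from (inj₂ (inj₁ j+1≡L+1)) = trans (v-adj j j≤L) (∨-trueʳ {j ≡ᵇ 0} (≡ᵇ-true (suc-injective j+1≡L+1)))
      from (inj₂ (inj₂ (_ , ())))

    adj⇔ : ∀ i j → Position i → Position j → Adj⇔ i j
    adj⇔ i j (onPath i≤L) (onPath j≤L)
      rewrite cycleVertex-path i≤L | cycleVertex-path j≤L | vertex-adj P i j i≤L j≤L = to , from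
      where
      not-wrap : ∀ {j} → j ≤ L → suc j ≢ suc (suc L)
      not-wrap j≤L e = <-irrefl (suc-injective e) (s≤s j≤L)
      to : pathAdjℕ i j ≡ true → CycleConsecutive (suc (suc L)) i j
      to e = [ (λ c → inj₁ (inj₁ c)) , (λ c → inj₂ (inj₁ c)) ]′ (pathAdjℕ-true⁻ i j e)
      from : CycleConsecutive (suc (suc L)) i j → pathAdjℕ i j ≡ true
      from (inj₁ (inj₁ c)) = pathAdjℕ-true i j (inj₁ c)
      from (inj₁ (inj₂ (wrap , _))) = ⊥-elim (not-wrap i≤L wrap)
      from (inj₂ (inj₁ c)) = pathAdjℕ-true i j (inj₂ c)
      from (inj₂ (inj₂ (wrap , _))) = ⊥-elim (not-wrap j≤L wrap)
    adj⇔ i j (apex refl) (onPath j≤L) rewrite cycleVertex-apex | cycleVertex-path j≤L = apex-adj⇔ j j≤L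
    adj⇔ i j (onPath i≤L) (apex refl) rewrite cycleVertex-apex | cycleVertex-path i≤L | A-sym (vertex P i) v =
      (λ e → CycleConsecutive-sym (proj₁ (apex-adj⇔ i i≤L) e)) , (λ c → proj₂ (apex-adj⇔ i i≤L) (CycleConsecutive-sym c))
    adj⇔ i j (apex refl) (apex refl) rewrite cycleVertex-apex | A-irrefl v = (λ ()) , from
      where
      from : CycleConsecutive (suc (suc L)) (suc L) (suc L) → false ≡ true
      from (inj₁ (inj₁ e)) = ⊥-elim (<-irrefl (sym e) ≤-refl)
      from (inj₁ (inj₂ (_ , ())))
      from (inj₂ (inj₁ e)) = ⊥-elim (<-irrefl (sym e) ≤-refl)
      from (inj₂ (inj₂ (_ , ())))

    cycleVertex-inj : Injective _≡_ _≡_ (λ (a : Fin (suc (suc L))) → cycleVertex (toℕ a))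
    cycleVertex-inj {a} {b} e = FP.toℕ-injective (go (position (toℕ a) (FP.toℕ<n a)) (position (toℕ b) (FP.toℕ<n b)))
      where
      via : ∀ {u w} → cycleVertex (toℕ a) ≡ u → cycleVertex (toℕ b) ≡ w → u ≡ w
      via va vb = trans (sym va) (trans e vb)
      at-apex : ∀ {j} → j ≡ suc L → cycleVertex j ≡ v
      at-apex refl = cycleVertex-apex
      go : Position (toℕ a) → Position (toℕ b) → toℕ a ≡ toℕ b
      go (onPath a≤L) (onPath b≤L) = vertex-inj P _ _ a≤L b≤L (via (cycleVertex-path a≤L) (cycleVertex-path b≤L))
      go (onPath a≤L) (apex b≡) = ⊥-elim (v∉P _ a≤L (sym (via (cycleVertex-path a≤L) (at-apex b≡))))
      go (apex a≡) (onPath b≤L) = ⊥-elim (v∉P _ b≤L (via (at-apex a≡) (cycleVertex-path b≤L)))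
      go (apex a≡) (apex b≡) = trans a≡ (sym b≡)

    hole : InducedSubgraphOf (cycleAdj (suc (suc L))) G
    hole = (λ a → cycleVertex (toℕ a)) , cycleVertex-inj , λ a b →
      let pa = position (toℕ a) (FP.toℕ<n a)
          pb = position (toℕ b) (FP.toℕ<n b)
          (to , from) = adj⇔ (toℕ a) (toℕ b) pa pb
      in ≡true-ext (λ e → cycleAdj-true a b (to e)) (λ e → from (cycleAdj-true⁻ a b e))

  -- An induced H-graph with body u₀ … uᵢ, except that the edges a₁a₂ and b₁b₂ are left open:
  -- they only select the variant.
  record HFrame (i : ℕ) : Set where
    field
      body : InducedPath i
      a₁ a₂ b₁ b₂ : V
      a₁-body : ∀ j → j ≤ i → A a₁ (vertex body j) ≡ (j ≡ᵇ 0)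
      a₂-body : ∀ j → j ≤ i → A a₂ (vertex body j) ≡ (j ≡ᵇ 0)
      b₁-body : ∀ j → j ≤ i → A b₁ (vertex body j) ≡ (j ≡ᵇ i)
      b₂-body : ∀ j → j ≤ i → A b₂ (vertex body j) ≡ (j ≡ᵇ i)
      a₁≁b₁ : A a₁ b₁ ≡ false
      a₁≁b₂ : A a₁ b₂ ≡ false
      a₂≁b₁ : A a₂ b₁ ≡ false
      a₂≁b₂ : A a₂ b₂ ≡ false
      a₁≢a₂ : a₁ ≢ a₂
      b₁≢b₂ : b₁ ≢ b₂
      a₁≢b₁ : a₁ ≢ b₁
      a₁≢b₂ : a₁ ≢ b₂
      a₂≢b₁ : a₂ ≢ b₁
      a₂≢b₂ : a₂ ≢ b₂
      a₁∉body : ∀ j → j ≤ i → a₁ ≢ vertex body j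
      a₂∉body : ∀ j → j ≤ i → a₂ ≢ vertex body j
      b₁∉body : ∀ j → j ≤ i → b₁ ≢ vertex body j
      b₂∉body : ∀ j → j ≤ i → b₂ ≢ vertex body j

  module HEmbedding {i : ℕ} (H : HFrame i) (v : HVariant)
    (a-joined : A (HFrame.a₁ H) (HFrame.a₂ H) ≡ joinedFirst v)
    (b-joined : A (HFrame.b₁ H) (HFrame.b₂ H) ≡ joinedSecond v) where
    open HFrame H

    pendant : Fin 4 → V
    pendant F.zero = a₁
    pendant (F.suc F.zero) = a₂
    pendant (F.suc (F.suc F.zero)) = b₁
    pendant (F.suc (F.suc (F.suc F.zero))) = b₂

    embed : Fin (suc i) ⊎ Fin 4 → V
    embed (inj₁ a) = vertex body (toℕ a)
    embed (inj₂ e) = pendant e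

    pendant-body : ∀ e (a : Fin (suc i)) → A (pendant e) (vertex body (toℕ a)) ≡ attached i a e
    pendant-body F.zero a = a₁-body (toℕ a) (toℕ≤pred a)
    pendant-body (F.suc F.zero) a = a₂-body (toℕ a) (toℕ≤pred a)
    pendant-body (F.suc (F.suc F.zero)) a = b₁-body (toℕ a) (toℕ≤pred a)
    pendant-body (F.suc (F.suc (F.suc F.zero))) a = b₂-body (toℕ a) (toℕ≤pred a)

    pendant-adj : ∀ e e′ → A (pendant e) (pendant e′) ≡ extraAdj v e e′
    pendant-adj F.zero F.zero = A-irrefl a₁
    pendant-adj F.zero (F.suc F.zero) = a-joined
    pendant-adj F.zero (F.suc (F.suc F.zero)) = a₁≁b₁
    pendant-adj F.zero (F.suc (F.suc (F.suc F.zero))) = a₁≁b₂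
    pendant-adj (F.suc F.zero) F.zero = trans (A-sym a₂ a₁) a-joined
    pendant-adj (F.suc F.zero) (F.suc F.zero) = A-irrefl a₂
    pendant-adj (F.suc F.zero) (F.suc (F.suc F.zero)) = a₂≁b₁
    pendant-adj (F.suc F.zero) (F.suc (F.suc (F.suc F.zero))) = a₂≁b₂
    pendant-adj (F.suc (F.suc F.zero)) F.zero = trans (A-sym b₁ a₁) a₁≁b₁
    pendant-adj (F.suc (F.suc F.zero)) (F.suc F.zero) = trans (A-sym b₁ a₂) a₂≁b₁
    pendant-adj (F.suc (F.suc F.zero)) (F.suc (F.suc F.zero)) = A-irrefl b₁
    pendant-adj (F.suc (F.suc F.zero)) (F.suc (F.suc (F.suc F.zero))) = b-joined
    pendant-adj (F.suc (F.suc (F.suc F.zero))) F.zero = trans (A-sym b₂ a₁) a₁≁b₂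
    pendant-adj (F.suc (F.suc (F.suc F.zero))) (F.suc F.zero) = trans (A-sym b₂ a₂) a₂≁b₂
    pendant-adj (F.suc (F.suc (F.suc F.zero))) (F.suc (F.suc F.zero)) = trans (A-sym b₂ b₁) b-joined
    pendant-adj (F.suc (F.suc (F.suc F.zero))) (F.suc (F.suc (F.suc F.zero))) = A-irrefl b₂

    embed-adj : ∀ s t → A (embed s) (embed t) ≡ hAdj′ v i s t
    embed-adj (inj₁ a) (inj₁ b) = vertex-adj body (toℕ a) (toℕ b) (toℕ≤pred a) (toℕ≤pred b)
    embed-adj (inj₁ a) (inj₂ e) = trans (A-sym _ _) (pendant-body e a)
    embed-adj (inj₂ e) (inj₁ a) = pendant-body e a
    embed-adj (inj₂ e) (inj₂ e′) = pendant-adj e e′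

    pendant∉body : ∀ e (a : Fin (suc i)) → pendant e ≢ vertex body (toℕ a)
    pendant∉body F.zero a = a₁∉body _ (toℕ≤pred a)
    pendant∉body (F.suc F.zero) a = a₂∉body _ (toℕ≤pred a)
    pendant∉body (F.suc (F.suc F.zero)) a = b₁∉body _ (toℕ≤pred a)
    pendant∉body (F.suc (F.suc (F.suc F.zero))) a = b₂∉body _ (toℕ≤pred a)

    pendant-inj : ∀ e e′ → pendant e ≡ pendant e′ → e ≡ e′
    pendant-inj F.zero F.zero _ = refl
    pendant-inj F.zero (F.suc F.zero) p = ⊥-elim (a₁≢a₂ p)
    pendant-inj F.zero (F.suc (F.suc F.zero)) p = ⊥-elim (a₁≢b₁ p)
    pendant-inj F.zero (F.suc (F.suc (F.suc F.zero))) p = ⊥-elim (a₁≢b₂ p)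
    pendant-inj (F.suc F.zero) F.zero p = ⊥-elim (a₁≢a₂ (sym p))
    pendant-inj (F.suc F.zero) (F.suc F.zero) _ = refl
    pendant-inj (F.suc F.zero) (F.suc (F.suc F.zero)) p = ⊥-elim (a₂≢b₁ p)
    pendant-inj (F.suc F.zero) (F.suc (F.suc (F.suc F.zero))) p = ⊥-elim (a₂≢b₂ p)
    pendant-inj (F.suc (F.suc F.zero)) F.zero p = ⊥-elim (a₁≢b₁ (sym p))
    pendant-inj (F.suc (F.suc F.zero)) (F.suc F.zero) p = ⊥-elim (a₂≢b₁ (sym p))
    pendant-inj (F.suc (F.suc F.zero)) (F.suc (F.suc F.zero)) _ = refl
    pendant-inj (F.suc (F.suc F.zero)) (F.suc (F.suc (F.suc F.zero))) p = ⊥-elim (b₁≢b₂ p)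
    pendant-inj (F.suc (F.suc (F.suc F.zero))) F.zero p = ⊥-elim (a₁≢b₂ (sym p))
    pendant-inj (F.suc (F.suc (F.suc F.zero))) (F.suc F.zero) p = ⊥-elim (a₂≢b₂ (sym p))
    pendant-inj (F.suc (F.suc (F.suc F.zero))) (F.suc (F.suc F.zero)) p = ⊥-elim (b₁≢b₂ (sym p))
    pendant-inj (F.suc (F.suc (F.suc F.zero))) (F.suc (F.suc (F.suc F.zero))) _ = refl

    embed-inj : ∀ s t → embed s ≡ embed t → s ≡ t
    embed-inj (inj₁ a) (inj₁ b) e = cong inj₁ (FP.toℕ-injective (vertex-inj body _ _ (toℕ≤pred a) (toℕ≤pred b) e))
    embed-inj (inj₁ a) (inj₂ e′) e = ⊥-elim (pendant∉body e′ a (sym e))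
    embed-inj (inj₂ e′) (inj₁ a) e = ⊥-elim (pendant∉body e′ a e)
    embed-inj (inj₂ e₁) (inj₂ e₂) e = cong inj₂ (pendant-inj e₁ e₂ e)

    induced : InducedSubgraphOf (hAdj v i) G
    induced = (λ x → embed (splitAt (suc i) x))
            , (λ {x} {y} e → splitAt-injective (suc i) x y (embed-inj (splitAt (suc i) x) (splitAt (suc i) y) e))
            , (λ x y → trans (embed-adj (splitAt (suc i) x) (splitAt (suc i) y)) (sym (hAdj-splitAt v i x y)))

  HFrame-reverse : ∀ {i} → HFrame i → HFrame i
  HFrame-reverse {i} H = record
    { body = reverse body ; a₁ = b₁ ; a₂ = b₂ ; b₁ = a₁ ; b₂ = a₂
    ; a₁-body = λ j j≤i → trans (b₁-body (i ∸ j) (m∸n≤m i j)) (∸≡ᵇ-self i j j≤i)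
    ; a₂-body = λ j j≤i → trans (b₂-body (i ∸ j) (m∸n≤m i j)) (∸≡ᵇ-self i j j≤i)
    ; b₁-body = λ j j≤i → trans (a₁-body (i ∸ j) (m∸n≤m i j)) (∸≡ᵇ-zero i j j≤i)
    ; b₂-body = λ j j≤i → trans (a₂-body (i ∸ j) (m∸n≤m i j)) (∸≡ᵇ-zero i j j≤i)
    ; a₁≁b₁ = trans (A-sym b₁ a₁) a₁≁b₁ ; a₁≁b₂ = trans (A-sym b₁ a₂) a₂≁b₁
    ; a₂≁b₁ = trans (A-sym b₂ a₁) a₁≁b₂ ; a₂≁b₂ = trans (A-sym b₂ a₂) a₂≁b₂
    ; a₁≢a₂ = b₁≢b₂ ; b₁≢b₂ = a₁≢a₂
    ; a₁≢b₁ = λ e → a₁≢b₁ (sym e) ; a₁≢b₂ = λ e → a₂≢b₁ (sym e)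
    ; a₂≢b₁ = λ e → a₁≢b₂ (sym e) ; a₂≢b₂ = λ e → a₂≢b₂ (sym e)
    ; a₁∉body = λ j _ → b₁∉body (i ∸ j) (m∸n≤m i j) ; a₂∉body = λ j _ → b₂∉body (i ∸ j) (m∸n≤m i j)
    ; b₁∉body = λ j _ → a₁∉body (i ∸ j) (m∸n≤m i j) ; b₂∉body = λ j _ → a₂∉body (i ∸ j) (m∸n≤m i j) }
    where open HFrame H

  -- H′ is defined with the joined pair at u₀, so a frame joined only at uᵢ is reversed first.
  HFrame⇒induced : ∀ {i} → HFrame i → ∃ λ v → InducedSubgraphOf (hAdj v i) G
  HFrame⇒induced H with A (HFrame.a₁ H) (HFrame.a₂ H) in ea | A (HFrame.b₁ H) (HFrame.b₂ H) in eb
  ... | false | false = plain  , HEmbedding.induced H plain ea eb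
  ... | true  | false = single , HEmbedding.induced H single ea eb
  ... | true  | true  = double , HEmbedding.induced H double ea eb
  ... | false | true  = single , HEmbedding.induced (HFrame-reverse H) single eb ea

  -- `base` is only meaningful on 0 … len.
  record EmbeddedRake (K : ℕ) : Set where
    field
      len        : ℕ
      base       : ℕ → V
      tooth      : Fin K → V
      rootOf     : Fin K → ℕ
      base-inj   : ∀ i j → i ≤ len → j ≤ len → base i ≡ base j → i ≡ j
      tooth-inj  : ∀ s t → tooth s ≡ tooth t → s ≡ t
      rootOf-inj : ∀ s t → rootOf s ≡ rootOf t → s ≡ t
      rootOf≤len : ∀ t → rootOf t ≤ len
      tooth≢base : ∀ t i → i ≤ len → tooth t ≢ base i
      base-adj   : ∀ i → i < len → A (base i) (base (suc i)) ≡ true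
      tooth-adj  : ∀ t → A (tooth t) (base (rootOf t)) ≡ true

  IsDense : ∀ {K} → ℕ → EmbeddedRake K → Set
  IsDense {K} ℓ E = ∀ i → i + ℓ ≤ suc (EmbeddedRake.len E) →
    ∃ λ (t : Fin K) → i ≤ EmbeddedRake.rootOf E t × EmbeddedRake.rootOf E t < i + ℓ

  dec-true⁻ : ∀ {n} (a b : Fin n) → ⌊ a FP.≟ b ⌋ ≡ true → a ≡ b
  dec-true⁻ a b e with a FP.≟ b
  ... | yes a≡b = a≡b
  ... | no _ = ⊥-elim (false≢true e)
    where
    false≢true : false ≢ true
    false≢true ()

  dec-refl : ∀ {n} (a : Fin n) → ⌊ a FP.≟ a ⌋ ≡ true
  dec-refl a with a FP.≟ a
  ... | yes _ = refl
  ... | no a≢a = ⊥-elim (a≢a refl)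

  module ToRake {K : ℕ} (E : EmbeddedRake K) where
    open EmbeddedRake E

    rootFin : Fin K → Fin (suc len)
    rootFin t = fromℕ< (s≤s (rootOf≤len t))

    toℕ-rootFin : ∀ t → toℕ (rootFin t) ≡ rootOf t
    toℕ-rootFin t = FP.toℕ-fromℕ< (s≤s (rootOf≤len t))

    rake : Rake K
    rake = record
      { m = len
      ; root = rootFin
      ; root-inj = λ {s} {t} e → rootOf-inj s t (trans (sym (toℕ-rootFin s)) (trans (cong toℕ e) (toℕ-rootFin t))) }

    embed : Fin (suc len) ⊎ Fin K → V
    embed (inj₁ a) = base (toℕ a)
    embed (inj₂ t) = tooth t

    embed-inj : ∀ s t → embed s ≡ embed t → s ≡ t
    embed-inj (inj₁ a) (inj₁ b) e = cong inj₁ (FP.toℕ-injective (base-inj _ _ (toℕ≤pred a) (toℕ≤pred b) e))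
    embed-inj (inj₁ a) (inj₂ t) e = ⊥-elim (tooth≢base t _ (toℕ≤pred a) (sym e))
    embed-inj (inj₂ t) (inj₁ a) e = ⊥-elim (tooth≢base t _ (toℕ≤pred a) e)
    embed-inj (inj₂ s) (inj₂ t) e = cong inj₂ (tooth-inj s t e)

    embed-adj : ∀ s t → rakeAdj′ rake s t ≡ true → A (embed s) (embed t) ≡ true
    embed-adj (inj₁ a) (inj₁ b) e with pathAdjℕ-true⁻ (toℕ a) (toℕ b) e
    ... | inj₁ a+1≡b rewrite sym a+1≡b = base-adj (toℕ a) (subst (_≤ len) (sym a+1≡b) (toℕ≤pred b))
    ... | inj₂ b+1≡a rewrite sym b+1≡a = trans (A-sym _ _) (base-adj (toℕ b) (subst (_≤ len) (sym b+1≡a) (toℕ≤pred a)))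
    embed-adj (inj₁ a) (inj₂ t) e rewrite sym (dec-true⁻ (rootFin t) a e) | toℕ-rootFin t = trans (A-sym _ _) (tooth-adj t)
    embed-adj (inj₂ t) (inj₁ a) e rewrite sym (dec-true⁻ (rootFin t) a e) | toℕ-rootFin t = tooth-adj t

    subgraph : SubgraphOf (rakeAdj rake) G
    subgraph = (λ x → embed (splitAt (suc len) x))
             , (λ {x} {y} e → splitAt-injective (suc len) x y (embed-inj (splitAt (suc len) x) (splitAt (suc len) y) e))
             , (λ x y e → embed-adj (splitAt (suc len) x) (splitAt (suc len) y) (trans (sym (rakeAdj-splitAt rake x y)) e))

    dense : ∀ ℓ → IsDense ℓ E → Dense ℓ rake
    dense ℓ d i i+ℓ≤ with d i i+ℓ≤
    ... | t , lo , hi = t , subst (i ≤_) (sym (toℕ-rootFin t)) lo , subst (_< i + ℓ) (sym (toℕ-rootFin t)) hi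

  clamp : (m : ℕ) → ℕ → Fin (suc m)
  clamp m       zero    = F.zero
  clamp zero    (suc i) = F.zero
  clamp (suc m) (suc i) = F.suc (clamp m i)

  toℕ-clamp : ∀ m i → i ≤ m → toℕ (clamp m i) ≡ i
  toℕ-clamp m       zero    _         = refl
  toℕ-clamp (suc m) (suc i) (s≤s i≤m) = cong suc (toℕ-clamp m i i≤m)

  clamp-toℕ : ∀ m (a : Fin (suc m)) → clamp m (toℕ a) ≡ a
  clamp-toℕ m       F.zero    = refl
  clamp-toℕ (suc m) (F.suc a) = cong F.suc (clamp-toℕ m a)

  fromSubgraph : ∀ {K} (R : Rake K) → SubgraphOf (rakeAdj R) G → EmbeddedRake K
  fromSubgraph {K} R (f , f-inj , f-adj) = record
    { len = M ; base = base ; tooth = tooth ; rootOf = λ t → toℕ (root R t)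
    ; base-inj = λ i j i≤M j≤M e → trans (sym (toℕ-clamp M i i≤M))
                                     (trans (cong toℕ (FP.↑ˡ-injective K _ _ (f-inj e))) (toℕ-clamp M j j≤M))
    ; tooth-inj = λ s t e → FP.↑ʳ-injective (suc M) s t (f-inj e)
    ; rootOf-inj = λ s t e → root-inj R (FP.toℕ-injective e)
    ; rootOf≤len = λ t → toℕ≤pred (root R t)
    ; tooth≢base = λ t i _ e → tooth≢base (clamp M i) (f-inj e)
    ; base-adj = base-adj
    ; tooth-adj = tooth-adj }
    where
    M = m R
    base : ℕ → V
    base i = f (clamp M i ↑ˡ K)
    tooth : Fin K → V
    tooth t = f (suc M ↑ʳ t)
    splitAt-base : ∀ (a : Fin (suc M)) → splitAt (suc M) (a ↑ˡ K) ≡ inj₁ a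
    splitAt-base a = FP.splitAt-↑ˡ (suc M) a K
    splitAt-tooth : ∀ (t : Fin K) → splitAt (suc M) (suc M ↑ʳ t) ≡ inj₂ t
    splitAt-tooth t = FP.splitAt-↑ʳ (suc M) K t
    tooth≢base : ∀ {t} a → suc M ↑ʳ t ≢ a ↑ˡ K
    tooth≢base {t} a e with trans (sym (splitAt-tooth t)) (trans (cong (splitAt (suc M)) e) (splitAt-base a))
    ... | ()
    rakeAdj-base : ∀ (a b : Fin (suc M)) → rakeAdj R (a ↑ˡ K) (b ↑ˡ K) ≡ pathAdj a b
    rakeAdj-base a b = trans (rakeAdj-splitAt R (a ↑ˡ K) (b ↑ˡ K)) (cong₂ (rakeAdj′ R) (splitAt-base a) (splitAt-base b))
    base-adj : ∀ i → i < M → A (base i) (base (suc i)) ≡ true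
    base-adj i i<M = f-adj _ _ (trans (rakeAdj-base (clamp M i) (clamp M (suc i)))
      (subst₂ (λ u w → pathAdjℕ u w ≡ true) (sym (toℕ-clamp M i (<⇒≤ i<M))) (sym (toℕ-clamp M (suc i) i<M))
              (pathAdjℕ-suc i)))
    tooth-adj : ∀ t → A (tooth t) (base (toℕ (root R t))) ≡ true
    tooth-adj t rewrite clamp-toℕ M (root R t) = f-adj _ _
      (trans (rakeAdj-splitAt R (suc M ↑ʳ t) (root R t ↑ˡ K))
             (trans (cong₂ (rakeAdj′ R) (splitAt-tooth t) (splitAt-base (root R t))) (dec-refl (root R t))))

  restrict : ∀ {K K′} (E : EmbeddedRake K) (e : Fin K′ → Fin K) → (∀ s t → e s ≡ e t → s ≡ t)
    → (a b : ℕ) → a ≤ b → b ≤ EmbeddedRake.len E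
    → (∀ u → a ≤ EmbeddedRake.rootOf E (e u) × EmbeddedRake.rootOf E (e u) ≤ b) → EmbeddedRake K′
  restrict E e e-inj a b a≤b b≤len inside = record
    { len = b ∸ a ; base = λ i → base (a + i) ; tooth = λ u → tooth (e u) ; rootOf = λ u → rootOf (e u) ∸ a
    ; base-inj = λ i j i≤ j≤ q →
        +-cancelˡ-≡ a i j (base-inj (a + i) (a + j) (≤-trans (a+i≤b i≤) b≤len) (≤-trans (a+i≤b j≤) b≤len) q)
    ; tooth-inj = λ s t q → e-inj s t (tooth-inj (e s) (e t) q)
    ; rootOf-inj = λ s t q → e-inj s t (rootOf-inj (e s) (e t)
        (trans (sym (m+[n∸m]≡n (proj₁ (inside s)))) (trans (cong (a +_) q) (m+[n∸m]≡n (proj₁ (inside t))))))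
    ; rootOf≤len = λ u → ∸-monoˡ-≤ a (proj₂ (inside u))
    ; tooth≢base = λ u i i≤ → tooth≢base (e u) (a + i) (≤-trans (a+i≤b i≤) b≤len)
    ; base-adj = λ i i< → subst (λ z → A (base (a + i)) (base z) ≡ true) (sym (+-suc a i))
                            (base-adj (a + i) (<-≤-trans (subst (_≤ b) (+-suc a i) (a+i≤b i<)) b≤len))
    ; tooth-adj = λ u → subst (λ z → A (tooth (e u)) (base z) ≡ true) (sym (m+[n∸m]≡n (proj₁ (inside u)))) (tooth-adj (e u)) }
    where
    open EmbeddedRake E
    a+i≤b : ∀ {i} → i ≤ b ∸ a → a + i ≤ b
    a+i≤b {i} i≤ = subst (a + i ≤_) (m+[n∸m]≡n a≤b) (+-monoʳ-≤ a i≤)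

  record Gap {K : ℕ} (ℓ : ℕ) (E : EmbeddedRake K) : Set where
    field
      x y   : ℕ
      t₁ t₂ : Fin K
      root-t₁ : EmbeddedRake.rootOf E t₁ ≡ x
      root-t₂ : EmbeddedRake.rootOf E t₂ ≡ y
      1≤x : 1 ≤ x
      y<len : suc y ≤ EmbeddedRake.len E
      wide : suc x + ℓ ≤ y
      no-root-between : ∀ t → x < EmbeddedRake.rootOf E t → EmbeddedRake.rootOf E t < y → ⊥

  IsRoot : ∀ {K} → EmbeddedRake K → ℕ → Set
  IsRoot {K} E j = ∃ λ (t : Fin K) → EmbeddedRake.rootOf E t ≡ j

  isRoot? : ∀ {K} (E : EmbeddedRake K) j → Dec (IsRoot E j)
  isRoot? E j = FP.any? (λ t → EmbeddedRake.rootOf E t ≟ j)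

  -- The two teeth with extreme roots are discarded and the base is cut down to the segment [a, b]
  -- spanned by the remaining roots. If some ℓ-window of [a, b] has no root, the roots around it are
  -- strictly inside the original base, because the discarded roots lie beyond a and b.
  module DenseOrGap {k : ℕ} (ℓ : ℕ) (1≤ℓ : 1 ≤ ℓ) (E : EmbeddedRake (suc (suc k))) (u₀ : Fin k) where
    open EmbeddedRake E

    tmin = proj₁ (argmin rootOf)
    tmax = proj₁ (argmax rootOf)

    tmin-min : ∀ t → rootOf tmin ≤ rootOf t
    tmin-min = proj₂ (argmin rootOf)

    tmax-max : ∀ t → rootOf t ≤ rootOf tmax
    tmax-max = proj₂ (argmax rootOf)

    tmin≢tmax : tmin ≢ tmax
    tmin≢tmax q = FP.0≢1+n (rootOf-inj F.zero (F.suc F.zero) (≤-antisym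
       (≤-trans (tmax-max F.zero) (subst (λ z → rootOf z ≤ rootOf (F.suc F.zero)) q (tmin-min (F.suc F.zero))))
       (≤-trans (tmax-max (F.suc F.zero)) (subst (λ z → rootOf z ≤ rootOf F.zero) q (tmin-min F.zero)))))

    inner : Fin k → Fin (suc (suc k))
    inner u = punchIn tmin (punchIn (punchOut tmin≢tmax) u)

    inner-inj : ∀ s t → inner s ≡ inner t → s ≡ t
    inner-inj s t q = FP.punchIn-injective (punchOut tmin≢tmax) s t (FP.punchIn-injective tmin _ _ q)

    inner≢tmin : ∀ u → inner u ≢ tmin
    inner≢tmin u = FP.punchInᵢ≢i tmin (punchIn (punchOut tmin≢tmax) u)

    inner≢tmax : ∀ u → inner u ≢ tmax
    inner≢tmax u q = FP.punchInᵢ≢i (punchOut tmin≢tmax) u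
      (FP.punchIn-injective tmin _ _ (trans q (sym (FP.punchIn-punchOut tmin≢tmax))))

    inner-onto : ∀ t → t ≢ tmin → t ≢ tmax → ∃ λ u → inner u ≡ t
    inner-onto t t≢tmin t≢tmax =
      punchOut {i = punchOut tmin≢tmax} {j = q} j≢q ,
      trans (cong (punchIn tmin) (FP.punchIn-punchOut j≢q)) (FP.punchIn-punchOut tmin≢t)
      where
      tmin≢t : tmin ≢ t
      tmin≢t e = t≢tmin (sym e)
      q = punchOut tmin≢t
      j≢q : punchOut tmin≢tmax ≢ q
      j≢q e = t≢tmax (trans (sym (FP.punchIn-punchOut tmin≢t))
                       (trans (cong (punchIn tmin) (sym e)) (FP.punchIn-punchOut tmin≢tmax)))

    a b : ℕ
    a = rootOf (inner (proj₁ (argminFrom u₀ (λ u → rootOf (inner u)))))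
    b = rootOf (inner (proj₁ (argmaxFrom u₀ (λ u → rootOf (inner u)))))

    a≤inner : ∀ u → a ≤ rootOf (inner u)
    a≤inner = proj₂ (argminFrom u₀ (λ u → rootOf (inner u)))

    inner≤b : ∀ u → rootOf (inner u) ≤ b
    inner≤b = proj₂ (argmaxFrom u₀ (λ u → rootOf (inner u)))

    a≤b : a ≤ b
    a≤b = inner≤b _

    tmin<a : rootOf tmin < a
    tmin<a = ≤∧≢⇒< (tmin-min _) (λ q → inner≢tmin _ (sym (rootOf-inj _ _ q)))

    b<tmax : b < rootOf tmax
    b<tmax = ≤∧≢⇒< (tmax-max _) (λ q → inner≢tmax _ (rootOf-inj _ _ q))

    b≤len : b ≤ len
    b≤len = ≤-trans (<⇒≤ b<tmax) (rootOf≤len tmax)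

    restricted : EmbeddedRake k
    restricted = restrict E inner inner-inj a b a≤b b≤len (λ u → a≤inner u , inner≤b u)

    Window : ℕ → Set
    Window c = ∃ λ t → c ≤ rootOf t × rootOf t < c + ℓ

    window? : ∀ c → Dec (Window c)
    window? c = FP.any? (λ t → (c ≤? rootOf t) D.×-dec (suc (rootOf t) ≤? c + ℓ))

    EmptyWindow : ℕ → Set
    EmptyWindow c = a ≤ c × c + ℓ ≤ suc b × ¬ Window c

    emptyWindow? : ∀ c → Dec (EmptyWindow c)
    emptyWindow? c = (a ≤? c) D.×-dec ((c + ℓ ≤? suc b) D.×-dec D.¬? (window? c))

    c<c+ℓ : ∀ c → c < c + ℓ
    c<c+ℓ c = subst (_≤ c + ℓ) (+-comm c 1) (+-monoʳ-≤ c 1≤ℓ)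

    dense : (∀ c → a ≤ c → c + ℓ ≤ suc b → Window c) → IsDense ℓ restricted
    dense full i i+ℓ≤ = u , lower , upper
      where
      fits : a + i + ℓ ≤ suc b
      fits = subst (_≤ suc b) (sym (+-assoc a i ℓ))
               (subst (a + (i + ℓ) ≤_) (trans (+-suc a (b ∸ a)) (cong suc (m+[n∸m]≡n a≤b))) (+-monoʳ-≤ a i+ℓ≤))
      w = full (a + i) (m≤m+n a i) fits
      t = proj₁ w
      t-lo : a + i ≤ rootOf t
      t-lo = proj₁ (proj₂ w)
      t-hi : rootOf t < a + i + ℓ
      t-hi = proj₂ (proj₂ w)
      t≢tmin : t ≢ tmin
      t≢tmin q = <-irrefl refl (<-≤-trans tmin<a (≤-trans (m≤m+n a i) (subst (a + i ≤_) (cong rootOf q) t-lo)))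
      t≢tmax : t ≢ tmax
      t≢tmax q = <-irrefl refl (<-≤-trans b<tmax (≤-pred (≤-trans (subst (λ z → suc (rootOf z) ≤ a + i + ℓ) q t-hi) fits)))
      u = proj₁ (inner-onto t t≢tmin t≢tmax)
      root-u : rootOf (inner u) ≡ rootOf t
      root-u = cong rootOf (proj₂ (inner-onto t t≢tmin t≢tmax))
      lower : i ≤ rootOf (inner u) ∸ a
      lower = subst (i ≤_) (cong (_∸ a) (sym root-u)) (subst (_≤ rootOf t ∸ a) (m+n∸m≡n a i) (∸-monoˡ-≤ a t-lo))
      upper : rootOf (inner u) ∸ a < i + ℓ
      upper = subst (_< i + ℓ) (cong (_∸ a) (sym root-u)) (+-cancelˡ-< a (rootOf t ∸ a) (i + ℓ)
                (subst₂ _<_ (sym (m+[n∸m]≡n (≤-trans (m≤m+n a i) t-lo))) (+-assoc a i ℓ) t-hi))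

    gap : ∀ c → EmptyWindow c → Gap ℓ E
    gap c (a≤c , c+ℓ≤ , empty) = record
      { x = x ; y = y ; t₁ = proj₁ root-x ; t₂ = proj₁ root-y ; root-t₁ = proj₂ root-x ; root-t₂ = proj₂ root-y
      ; 1≤x = ≤-trans (s≤s z≤n) (≤-trans tmin<a a≤x) ; y<len = ≤-trans (s≤s y≤b) (≤-trans b<tmax (rootOf≤len tmax))
      ; wide = ≤-trans (+-monoˡ-≤ ℓ x<c) c+ℓ≤y ; no-root-between = between }
      where
      ua = inner (proj₁ (argminFrom u₀ (λ u → rootOf (inner u))))
      ub = inner (proj₁ (argmaxFrom u₀ (λ u → rootOf (inner u))))
      a<c : a < c
      a<c = ≤∧≢⇒< a≤c (λ q → empty (ua , subst (_≤ a) q ≤-refl , ≤-trans (s≤s (≤-reflexive q)) (c<c+ℓ c)))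
      c+ℓ≤b : c + ℓ ≤ b
      c+ℓ≤b with m≤n⇒m<n∨m≡n c+ℓ≤
      ... | inj₁ lt = ≤-pred lt
      ... | inj₂ q = ⊥-elim (empty (ub , ≤-pred (≤-trans (c<c+ℓ c) (≤-reflexive q)) , ≤-reflexive (sym q)))
      below = greatestBelow c (IsRoot E) (isRoot? E) (a , a<c , ua , refl)
      x = proj₁ below
      x<c : x < c
      x<c = proj₁ (proj₂ below)
      root-x = proj₁ (proj₂ (proj₂ below))
      none-above-x = proj₂ (proj₂ (proj₂ below))
      a≤x : a ≤ x
      a≤x with a ≤? x
      ... | yes a≤x = a≤x
      ... | no a≰x = ⊥-elim (none-above-x a (≰⇒> a≰x) a<c (ua , refl))
      above = leastFrom (c + ℓ) (b ∸ (c + ℓ)) (IsRoot E) (isRoot? E) (ub , sym (m+[n∸m]≡n c+ℓ≤b))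
      y = proj₁ above
      c+ℓ≤y : c + ℓ ≤ y
      c+ℓ≤y = proj₁ (proj₂ above)
      y≤b : y ≤ b
      y≤b = subst (y ≤_) (m+[n∸m]≡n c+ℓ≤b) (proj₁ (proj₂ (proj₂ above)))
      root-y = proj₁ (proj₂ (proj₂ (proj₂ above)))
      none-below-y = proj₂ (proj₂ (proj₂ (proj₂ above)))
      between : ∀ t → x < rootOf t → rootOf t < y → ⊥
      between t x< <y with c ≤? rootOf t
      ... | no c≰ = none-above-x (rootOf t) x< (≰⇒> c≰) (t , refl)
      ... | yes c≤ with suc (rootOf t) ≤? c + ℓ
      ...   | yes <c+ℓ = empty (t , c≤ , <c+ℓ)
      ...   | no ≮c+ℓ = none-below-y (rootOf t) (≤-pred (≰⇒> ≮c+ℓ)) <y (t , refl)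

    result : Σ (EmbeddedRake k) (IsDense ℓ) ⊎ Gap ℓ E
    result with search< (suc b) EmptyWindow emptyWindow?
    ... | inj₁ (c , _ , ew) = inj₂ (gap c ew)
    ... | inj₂ none = inj₁ (restricted , dense full)
      where
      full : ∀ c → a ≤ c → c + ℓ ≤ suc b → Window c
      full c a≤c c+ℓ≤ = decidable-stable (window? c)
        (λ ¬w → none c (<-≤-trans (c<c+ℓ c) c+ℓ≤) (a≤c , c+ℓ≤ , ¬w))

  denseOrGap : ∀ k ℓ → 2 ≤ ℓ → (E : EmbeddedRake (suc (suc k))) → Σ (EmbeddedRake k) (IsDense ℓ) ⊎ Gap ℓ E
  denseOrGap zero ℓ 2≤ℓ E =
    inj₁ ( restrict E (λ ()) (λ ()) 0 0 z≤n z≤n (λ ())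
         , λ i i+ℓ≤1 → ⊥-elim (2≰1 (≤-trans (≤-trans 2≤ℓ (m≤n+m ℓ i)) i+ℓ≤1)))
    where
    2≰1 : ¬ 2 ≤ 1
    2≰1 (s≤s ())
  denseOrGap (suc k) ℓ 2≤ℓ E = DenseOrGap.result ℓ (≤-trans (s≤s z≤n) 2≤ℓ) E F.zero

  Shorter : ∀ {K} → EmbeddedRake K → Set
  Shorter {K} E = Σ (EmbeddedRake K) λ E′ → EmbeddedRake.len E′ < EmbeddedRake.len E

  module _ {K : ℕ} (E : EmbeddedRake K) where
    open EmbeddedRake E

    -- Base vertices a+1 … a+1+d are replaced by the single vertex w, and the tooth t* by the
    -- pendant v* rooted at the new position r*.
    record Shortcut : Set where
      field
        a d   : ℕ
        w v*  : V
        t*    : Fin K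
        r*    : ℕ
        1≤d   : 1 ≤ d
        fits  : suc a + d ≤ len
        w∉prefix : ∀ j → j ≤ a → w ≢ base j
        w∉suffix : ∀ j → suc (suc a) + d ≤ j → j ≤ len → w ≢ base j
        base-a~w : A (base a) w ≡ true
        w~suffix : suc (suc a) + d ≤ len → A w (base (suc (suc a) + d)) ≡ true
        roots-outside : ∀ t → t ≢ t* → rootOf t ≤ a ⊎ suc a + d ≤ rootOf t
        root-at-w : ∀ t → t ≢ t* → rootOf t ≡ suc a + d → w ≡ base (suc a + d)
        tooth≢w  : ∀ t → t ≢ t* → tooth t ≢ w
        v*≢tooth : ∀ t → t ≢ t* → v* ≢ tooth t
        v*∉base  : ∀ j → j ≤ len → j ≤ a ⊎ suc (suc a) + d ≤ j → v* ≢ base j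
        v*≢w     : v* ≢ w
        r*≤      : r* ≤ len ∸ d
        r*-fresh-prefix : ∀ t → t ≢ t* → rootOf t ≤ a → r* ≢ rootOf t
        r*-fresh-suffix : ∀ t → t ≢ t* → suc a + d ≤ rootOf t → r* + d ≢ rootOf t
        v*-adj : (r* ≤ a × A v* (base r*) ≡ true) ⊎ (r* ≡ suc a × A v* w ≡ true)
               ⊎ (suc (suc a) ≤ r* × A v* (base (r* + d)) ≡ true)

  module Shorten {K : ℕ} {E : EmbeddedRake K} (S : Shortcut E) where
    open EmbeddedRake E
    open Shortcut S

    len′ : ℕ
    len′ = len ∸ d

    len′+d≡len : len′ + d ≡ len
    len′+d≡len = m∸n+n≡m (≤-trans (m≤n+m d (suc a)) fits)

    β : ℕ → V
    β i with region a i
    ... | prefix _ = base i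
    ... | middle _ = w
    ... | suffix _ = base (i + d)

    β-prefix : ∀ {i} → i ≤ a → β i ≡ base i
    β-prefix {i} i≤a with region a i
    ... | prefix _ = refl
    ... | middle e = ⊥-elim (<-irrefl refl (subst (_≤ a) e i≤a))
    ... | suffix q = ⊥-elim (<-irrefl refl (≤-trans q (≤-trans i≤a (n≤1+n a))))

    β-middle : ∀ {i} → i ≡ suc a → β i ≡ w
    β-middle refl with region a (suc a)
    ... | prefix h = ⊥-elim (<-irrefl refl h)
    ... | middle _ = refl
    ... | suffix q = ⊥-elim (<-irrefl refl q)

    β-suffix : ∀ {i} → suc (suc a) ≤ i → β i ≡ base (i + d)
    β-suffix {i} a+2≤i with region a i
    ... | prefix q = ⊥-elim (<-irrefl refl (≤-trans a+2≤i (≤-trans q (n≤1+n a))))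
    ... | middle e = ⊥-elim (<-irrefl refl (subst (suc (suc a) ≤_) e a+2≤i))
    ... | suffix _ = refl

    shift : ℕ → ℕ
    shift r with r ≤? a
    ... | yes _ = r
    ... | no _ = r ∸ d

    shift-prefix : ∀ {r} → r ≤ a → shift r ≡ r
    shift-prefix {r} r≤a with r ≤? a
    ... | yes _ = refl
    ... | no r≰a = ⊥-elim (r≰a r≤a)

    shift-suffix : ∀ {r} → suc a + d ≤ r → shift r + d ≡ r
    shift-suffix {r} r≥ with r ≤? a
    ... | yes r≤a = ⊥-elim (<-irrefl refl (≤-trans (≤-trans (m≤m+n (suc a) d) r≥) r≤a))
    ... | no _ = m∸n+n≡m (≤-trans (m≤n+m d (suc a)) r≥)

    shift-suffix′ : ∀ {r} → suc a + d ≤ r → suc a ≤ shift r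
    shift-suffix′ {r} r≥ = +-cancelʳ-≤ d (suc a) (shift r) (subst (suc a + d ≤_) (sym (shift-suffix r≥)) r≥)

    tooth′ : Fin K → V
    tooth′ t with t FP.≟ t*
    ... | yes _ = v*
    ... | no _ = tooth t

    rootOf′ : Fin K → ℕ
    rootOf′ t with t FP.≟ t*
    ... | yes _ = r*
    ... | no _ = shift (rootOf t)

    prefix≤len : ∀ {i} → i ≤ a → i ≤ len
    prefix≤len i≤a = ≤-trans (≤-trans i≤a (n≤1+n a)) (≤-trans (m≤m+n (suc a) d) fits)

    +d≤len : ∀ {i} → i ≤ len′ → i + d ≤ len
    +d≤len {i} i≤ = subst (i + d ≤_) len′+d≡len (+-monoˡ-≤ d i≤)

    a<len′ : suc a ≤ len′
    a<len′ = +-cancelʳ-≤ d (suc a) len′ (subst (suc a + d ≤_) (sym len′+d≡len) fits)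

    prefix≢suffix : ∀ {i k} → i ≤ a → suc (suc a) ≤ k → i ≢ k
    prefix≢suffix i≤a a+2≤k refl = <-irrefl refl (≤-trans (s≤s i≤a) (≤-trans (n≤1+n (suc a)) a+2≤k))

    β-inj : ∀ i j → i ≤ len′ → j ≤ len′ → β i ≡ β j → i ≡ j
    β-inj i j i≤ j≤ e = go (region a i) (region a j)
      where
      via : ∀ {u v} → β i ≡ u → β j ≡ v → u ≡ v
      via βi βj = trans (sym βi) (trans e βj)
      go : Region a i → Region a j → i ≡ j
      go (prefix p) (prefix q) = base-inj i j (prefix≤len p) (prefix≤len q) (via (β-prefix p) (β-prefix q))
      go (prefix p) (middle q) = ⊥-elim (w∉prefix i p (sym (via (β-prefix p) (β-middle q))))
      go (prefix p) (suffix q) = ⊥-elim (prefix≢suffix p (≤-trans q (m≤m+n j d))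
                                   (base-inj i (j + d) (prefix≤len p) (+d≤len j≤) (via (β-prefix p) (β-suffix q))))
      go (middle p) (prefix q) = ⊥-elim (w∉prefix j q (via (β-middle p) (β-prefix q)))
      go (middle p) (middle q) = trans p (sym q)
      go (middle p) (suffix q) = ⊥-elim (w∉suffix (j + d) (+-monoˡ-≤ d q) (+d≤len j≤) (via (β-middle p) (β-suffix q)))
      go (suffix p) (prefix q) = ⊥-elim (prefix≢suffix q (≤-trans p (m≤m+n i d))
                                   (base-inj j (i + d) (prefix≤len q) (+d≤len i≤) (sym (via (β-suffix p) (β-prefix q)))))
      go (suffix p) (middle q) = ⊥-elim (w∉suffix (i + d) (+-monoˡ-≤ d p) (+d≤len i≤) (sym (via (β-suffix p) (β-middle q))))
      go (suffix p) (suffix q) = +-cancelʳ-≡ d i j (base-inj (i + d) (j + d) (+d≤len i≤) (+d≤len j≤) (via (β-suffix p) (β-suffix q)))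

    tooth′-inj : ∀ s t → tooth′ s ≡ tooth′ t → s ≡ t
    tooth′-inj s t e with s FP.≟ t* | t FP.≟ t*
    ... | yes s≡ | yes t≡ = trans s≡ (sym t≡)
    ... | yes _  | no t≢ = ⊥-elim (v*≢tooth t t≢ e)
    ... | no s≢  | yes _ = ⊥-elim (v*≢tooth s s≢ (sym e))
    ... | no _   | no _  = tooth-inj s t e

    shift-inj : ∀ s t → s ≢ t* → t ≢ t* → shift (rootOf s) ≡ shift (rootOf t) → rootOf s ≡ rootOf t
    shift-inj s t s≢ t≢ e with roots-outside s s≢ | roots-outside t t≢
    ... | inj₁ p | inj₁ q = trans (sym (shift-prefix p)) (trans e (shift-prefix q))
    ... | inj₁ p | inj₂ q = ⊥-elim (<-irrefl refl (≤-trans (s≤s p) (subst (suc a ≤_) (trans (sym e) (shift-prefix p)) (shift-suffix′ q))))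
    ... | inj₂ p | inj₁ q = ⊥-elim (<-irrefl refl (≤-trans (s≤s q) (subst (suc a ≤_) (trans e (shift-prefix q)) (shift-suffix′ p))))
    ... | inj₂ p | inj₂ q = trans (sym (shift-suffix p)) (trans (cong (_+ d) e) (shift-suffix q))

    r*≢shift : ∀ t → t ≢ t* → r* ≢ shift (rootOf t)
    r*≢shift t t≢ e with roots-outside t t≢
    ... | inj₁ q = r*-fresh-prefix t t≢ q (trans e (shift-prefix q))
    ... | inj₂ q = r*-fresh-suffix t t≢ q (trans (cong (_+ d) e) (shift-suffix q))

    rootOf′-inj : ∀ s t → rootOf′ s ≡ rootOf′ t → s ≡ t
    rootOf′-inj s t e with s FP.≟ t* | t FP.≟ t*
    ... | yes s≡ | yes t≡ = trans s≡ (sym t≡)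
    ... | yes _  | no t≢ = ⊥-elim (r*≢shift t t≢ e)
    ... | no s≢  | yes _ = ⊥-elim (r*≢shift s s≢ (sym e))
    ... | no s≢  | no t≢ = rootOf-inj s t (shift-inj s t s≢ t≢ e)

    rootOf′≤len′ : ∀ t → rootOf′ t ≤ len′
    rootOf′≤len′ t with t FP.≟ t*
    ... | yes _ = r*≤
    ... | no t≢ with roots-outside t t≢
    ...   | inj₁ q rewrite shift-prefix q = ≤-trans (≤-trans q (n≤1+n a)) a<len′
    ...   | inj₂ q = +-cancelʳ-≤ d (shift (rootOf t)) len′ (subst₂ _≤_ (sym (shift-suffix q)) (sym len′+d≡len) (rootOf≤len t))

    β-cases : ∀ i → i ≤ len′ → (∃ λ j → j ≤ len × (j ≤ a ⊎ suc (suc a) + d ≤ j) × β i ≡ base j) ⊎ β i ≡ w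
    β-cases i i≤ = go (region a i)
      where
      go : Region a i → (∃ λ j → j ≤ len × (j ≤ a ⊎ suc (suc a) + d ≤ j) × β i ≡ base j) ⊎ β i ≡ w
      go (prefix p) = inj₁ (i , prefix≤len p , inj₁ p , β-prefix p)
      go (middle p) = inj₂ (β-middle p)
      go (suffix p) = inj₁ (i + d , +d≤len i≤ , inj₂ (+-monoˡ-≤ d p) , β-suffix p)

    tooth′≢β : ∀ t i → i ≤ len′ → tooth′ t ≢ β i
    tooth′≢β t i i≤ e with t FP.≟ t* | β-cases i i≤
    ... | yes _  | inj₁ (j , j≤ , c , q) = v*∉base j j≤ c (trans e q)
    ... | yes _  | inj₂ q = v*≢w (trans e q)
    ... | no _   | inj₁ (j , j≤ , c , q) = tooth≢base t j j≤ (trans e q)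
    ... | no t≢  | inj₂ q = tooth≢w t t≢ (trans e q)

    β-adj : ∀ i → i < len′ → A (β i) (β (suc i)) ≡ true
    β-adj i i< = go (region a i)
      where
      go : Region a i → A (β i) (β (suc i)) ≡ true
      go (prefix p) with m≤n⇒m<n∨m≡n p
      ... | inj₁ q rewrite β-prefix p | β-prefix q = base-adj i (<-≤-trans q (prefix≤len ≤-refl))
      ... | inj₂ refl rewrite β-prefix (≤-refl {a}) | β-middle {suc a} refl = base-a~w
      go (middle refl) rewrite β-middle {suc a} refl | β-suffix (≤-refl {suc (suc a)}) =
        w~suffix (subst (suc (suc a) + d ≤_) len′+d≡len (+-monoˡ-≤ d i<))
      go (suffix p) rewrite β-suffix p | β-suffix (≤-trans p (n≤1+n i)) = base-adj (i + d) (+d≤len i<)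

    v*-adj′ : A v* (β r*) ≡ true
    v*-adj′ with v*-adj
    ... | inj₁ (p , v*~) = subst (λ z → A v* z ≡ true) (sym (β-prefix p)) v*~
    ... | inj₂ (inj₁ (p , v*~)) = subst (λ z → A v* z ≡ true) (sym (β-middle p)) v*~
    ... | inj₂ (inj₂ (p , v*~)) = subst (λ z → A v* z ≡ true) (sym (β-suffix p)) v*~

    β-shift : ∀ t → t ≢ t* → suc a + d ≤ rootOf t → β (shift (rootOf t)) ≡ base (rootOf t)
    β-shift t t≢ r≥ with m≤n⇒m<n∨m≡n r≥
    ... | inj₁ r> = trans (β-suffix a+2≤shift) (cong base (shift-suffix r≥))
      where
      a+2≤shift : suc (suc a) ≤ shift (rootOf t)
      a+2≤shift = +-cancelʳ-≤ d (suc (suc a)) (shift (rootOf t)) (subst (suc (suc a) + d ≤_) (sym (shift-suffix r≥)) r>)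
    ... | inj₂ r≡ = trans (β-middle shift≡) (trans (root-at-w t t≢ (sym r≡)) (cong base r≡))
      where
      shift≡ : shift (rootOf t) ≡ suc a
      shift≡ = +-cancelʳ-≡ d (shift (rootOf t)) (suc a) (trans (shift-suffix r≥) (sym r≡))

    tooth′-adj : ∀ t → A (tooth′ t) (β (rootOf′ t)) ≡ true
    tooth′-adj t with t FP.≟ t*
    ... | yes _ = v*-adj′
    ... | no t≢ with roots-outside t t≢
    ...   | inj₁ q rewrite shift-prefix q | β-prefix q = tooth-adj t
    ...   | inj₂ q = subst (λ z → A (tooth t) z ≡ true) (sym (β-shift t t≢ q)) (tooth-adj t)

    shortened : EmbeddedRake K
    shortened = record
      { len = len′ ; base = β ; tooth = tooth′ ; rootOf = rootOf′
      ; base-inj = β-inj ; tooth-inj = tooth′-inj ; rootOf-inj = rootOf′-inj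
      ; rootOf≤len = rootOf′≤len′ ; tooth≢base = tooth′≢β
      ; base-adj = β-adj ; tooth-adj = tooth′-adj }

    shorter : Shorter E
    shorter = shortened , subst (len′ <_) len′+d≡len (subst (_≤ len′ + d) (+-comm len′ 1) (+-monoʳ-≤ len′ 1≤d))

  shorten : ∀ {K} {E : EmbeddedRake K} → Shortcut E → Shorter E
  shorten S = Shorten.shorter S

  module GapAnalysis (s : ℕ) {K : ℕ} (E : EmbeddedRake K) (gap : Gap (s + 5) E) where
    open EmbeddedRake E
    open Gap gap

    T₁ T₂ : V
    T₁ = tooth t₁
    T₂ = tooth t₂

    x₀ : ℕ
    x₀ = pred x

    x₀+1≡x : suc x₀ ≡ x
    x₀+1≡x with x | 1≤x
    ... | suc _ | _ = refl

    L₁ R₁ : V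
    L₁ = base x₀
    R₁ = base (suc y)

    y≤len : y ≤ len
    y≤len = ≤-trans (n≤1+n y) y<len

    x+s+6≤y : x + (s + 6) ≤ y
    x+s+6≤y = subst (_≤ y) (trans (sym (+-suc x (s + 5))) (cong (x +_) (sym (+-suc s 5)))) wide

    x+k≤y : ∀ k → k ≤ s + 6 → x + k ≤ y
    x+k≤y k h = ≤-trans (+-monoʳ-≤ x h) x+s+6≤y

    x≤y : x ≤ y
    x≤y = ≤-trans (m≤m+n x (s + 6)) x+s+6≤y

    x≤len : x ≤ len
    x≤len = ≤-trans x≤y y≤len

    ≤s+6 : ∀ {k} → k ≤ 6 → k ≤ s + 6
    ≤s+6 {k} h = ≤-trans h (m≤n+m 6 s)

    base-≢ : ∀ {i j} → i ≤ len → j ≤ len → i ≢ j → base i ≢ base j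
    base-≢ hi hj ne e = ne (base-inj _ _ hi hj e)

    base-≢< : ∀ {i j} → i < j → j ≤ len → base j ≢ base i
    base-≢< i<j j≤len e = <⇒≢ i<j (sym (base-inj _ _ j≤len (≤-trans (<⇒≤ i<j) j≤len) e))

    tooth∉base : ∀ t {i} → i ≤ len → tooth t ≢ base i
    tooth∉base t h = tooth≢base t _ h

    T₁~x : A T₁ (base x) ≡ true
    T₁~x = subst (λ z → A T₁ (base z) ≡ true) root-t₁ (tooth-adj t₁)

    T₂~y : A T₂ (base y) ≡ true
    T₂~y = subst (λ z → A T₂ (base z) ≡ true) root-t₂ (tooth-adj t₂)

    t₁≢t₂ : t₁ ≢ t₂
    t₁≢t₂ e = <⇒≢ (≤-trans (m≤m+n (suc x) (s + 5)) wide) (trans (sym root-t₁) (trans (cong rootOf e) root-t₂))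

    root-outside : ∀ t → rootOf t ≤ x ⊎ y ≤ rootOf t
    root-outside t with rootOf t ≤? x
    ... | yes h = inj₁ h
    ... | no h with y ≤? rootOf t
    ... | yes h' = inj₂ h'
    ... | no h' = ⊥-elim (no-root-between t (≰⇒> h) (≰⇒> h'))

    no-root-at : ∀ t {p} → x < p → p < y → rootOf t ≢ p
    no-root-at t h1 h2 e = no-root-between t (subst (x <_) (sym e) h1) (subst (_< y) (sym e) h2)

    ≤len∸ : ∀ {i d} → i + d ≤ len → i ≤ len ∸ d
    ≤len∸ {i} {d} h = subst (_≤ len ∸ d) (m+n∸n≡m i d) (∸-monoˡ-≤ d h)

    shortcut-chord : ∀ p d → 1 ≤ d → x ≤ p → suc p + d ≤ y → A (base p) (base (suc p + d)) ≡ true → Shorter E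
    shortcut-chord p d 1≤d x≤p p+1+d≤y edge = shorten {E = E} record
      { a = p ; d = d ; w = base (suc p + d) ; t* = t₁ ; v* = T₁ ; r* = x ; 1≤d = 1≤d ; fits = fits
      ; w∉prefix = w∉prefix ; w∉suffix = w∉suffix ; base-a~w = edge ; w~suffix = base-adj (suc p + d)
      ; roots-outside = roots-outside ; root-at-w = λ _ _ _ → refl ; tooth≢w = λ t _ → tooth∉base t fits
      ; v*≢tooth = λ t nt q → nt (tooth-inj _ _ (sym q)) ; v*∉base = λ j hj _ → tooth∉base t₁ hj ; v*≢w = tooth∉base t₁ fits
      ; r*≤ = r*≤ ; r*-fresh-prefix = r*-fresh-prefix ; r*-fresh-suffix = r*-fresh-suffix ; v*-adj = inj₁ (x≤p , T₁~x) }
      where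
      fits : suc p + d ≤ len
      fits = ≤-trans p+1+d≤y y≤len
      w∉prefix : ∀ j → j ≤ p → base (suc p + d) ≢ base j
      w∉prefix j h = base-≢< (≤-trans (s≤s h) (m≤m+n (suc p) d)) fits
      w∉suffix : ∀ j → suc (suc p) + d ≤ j → j ≤ len → base (suc p + d) ≢ base j
      w∉suffix j h hj = base-≢ fits hj (<⇒≢ h)
      roots-outside : ∀ t → t ≢ t₁ → rootOf t ≤ p ⊎ suc p + d ≤ rootOf t
      roots-outside t _ with root-outside t
      ... | inj₁ h = inj₁ (≤-trans h x≤p)
      ... | inj₂ h = inj₂ (≤-trans p+1+d≤y h)
      r*≤ : x ≤ len ∸ d
      r*≤ = ≤len∸ (≤-trans (+-monoˡ-≤ d (≤-trans x≤p (n≤1+n p))) fits)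
      r*-fresh-prefix : ∀ t → t ≢ t₁ → rootOf t ≤ p → x ≢ rootOf t
      r*-fresh-prefix t nt _ q = nt (rootOf-inj _ _ (trans (sym q) (sym root-t₁)))
      r*-fresh-suffix : ∀ t → t ≢ t₁ → suc p + d ≤ rootOf t → x + d ≢ rootOf t
      r*-fresh-suffix t _ h = <⇒≢ (≤-trans (s≤s (+-monoˡ-≤ d x≤p)) h)

    -- T₁ takes the place of base (x + 1), which in turn becomes the tooth at x.
    shortcut-T₁ : ∀ d → 1 ≤ d → suc (suc x) + d ≤ y → A T₁ (base (suc (suc x) + d)) ≡ true → Shorter E
    shortcut-T₁ d 1≤d x+2+d≤y edge = shorten {E = E} record
      { a = x ; d = d ; w = T₁ ; t* = t₁ ; v* = base (suc x) ; r* = x ; 1≤d = 1≤d ; fits = fits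
      ; w∉prefix = λ j h → tooth∉base t₁ (≤-trans h x≤len) ; w∉suffix = λ j _ hj → tooth∉base t₁ hj
      ; base-a~w = trans (A-sym _ _) T₁~x ; w~suffix = λ _ → edge
      ; roots-outside = roots-outside ; root-at-w = root-at-w ; tooth≢w = tooth≢w
      ; v*≢tooth = λ t _ q → tooth∉base t x+1≤len (sym q) ; v*∉base = v*∉base ; v*≢w = λ q → tooth∉base t₁ x+1≤len (sym q)
      ; r*≤ = r*≤ ; r*-fresh-prefix = r*-fresh-prefix ; r*-fresh-suffix = r*-fresh-suffix
      ; v*-adj = inj₁ (≤-refl , trans (A-sym _ _) (base-adj x x+1≤len)) }
      where
      x+2+d≤len : suc (suc x) + d ≤ len
      x+2+d≤len = ≤-trans x+2+d≤y y≤len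
      fits : suc x + d ≤ len
      fits = ≤-trans (n≤1+n _) x+2+d≤len
      x+1≤len : suc x ≤ len
      x+1≤len = ≤-trans (m≤m+n (suc x) d) fits
      roots-outside : ∀ t → t ≢ t₁ → rootOf t ≤ x ⊎ suc x + d ≤ rootOf t
      roots-outside t _ with root-outside t
      ... | inj₁ h = inj₁ h
      ... | inj₂ h = inj₂ (≤-trans (≤-trans (n≤1+n _) x+2+d≤y) h)
      root-at-w : ∀ t → t ≢ t₁ → rootOf t ≡ suc x + d → T₁ ≡ base (suc x + d)
      root-at-w t _ q = ⊥-elim (no-root-at t (s≤s (m≤m+n x d)) (≤-trans (≤-refl) x+2+d≤y) q)
      tooth≢w : ∀ t → t ≢ t₁ → tooth t ≢ T₁
      tooth≢w t nt q = nt (tooth-inj _ _ q)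
      v*∉base : ∀ j → j ≤ len → j ≤ x ⊎ suc (suc x) + d ≤ j → base (suc x) ≢ base j
      v*∉base j hj (inj₁ h) = base-≢< (s≤s h) x+1≤len
      v*∉base j hj (inj₂ h) = base-≢ x+1≤len hj (<⇒≢ (≤-trans (s≤s (s≤s (m≤m+n x d))) h))
      r*≤ : x ≤ len ∸ d
      r*≤ = ≤len∸ (≤-trans (n≤1+n _) fits)
      r*-fresh-prefix : ∀ t → t ≢ t₁ → rootOf t ≤ x → x ≢ rootOf t
      r*-fresh-prefix t nt _ q = nt (rootOf-inj _ _ (trans (sym q) (sym root-t₁)))
      r*-fresh-suffix : ∀ t → t ≢ t₁ → suc x + d ≤ rootOf t → x + d ≢ rootOf t
      r*-fresh-suffix t _ h = <⇒≢ h

    shortcut-T₂ : ∀ p d → 1 ≤ d → x ≤ p → suc (suc p) + d ≡ y → A T₂ (base p) ≡ true → Shorter E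
    shortcut-T₂ p d 1≤d x≤p refl edge = shorten {E = E} record
      { a = p ; d = d ; w = T₂ ; t* = t₂ ; v* = base (suc p + d) ; r* = suc (suc p) ; 1≤d = 1≤d ; fits = fits
      ; w∉prefix = λ j h → tooth∉base t₂ (≤-trans h p≤len) ; w∉suffix = λ j _ hj → tooth∉base t₂ hj
      ; base-a~w = trans (A-sym _ _) edge ; w~suffix = λ _ → T₂~y
      ; roots-outside = roots-outside ; root-at-w = root-at-w ; tooth≢w = tooth≢w
      ; v*≢tooth = λ t _ q → tooth∉base t fits (sym q) ; v*∉base = v*∉base ; v*≢w = λ q → tooth∉base t₂ fits (sym q)
      ; r*≤ = ≤len∸ y≤len ; r*-fresh-prefix = r*-fresh-prefix ; r*-fresh-suffix = r*-fresh-suffix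
      ; v*-adj = inj₂ (inj₂ (≤-refl , base-adj (suc p + d) y≤len)) }
      where
      fits : suc p + d ≤ len
      fits = ≤-trans (n≤1+n _) y≤len
      p≤len : p ≤ len
      p≤len = ≤-trans (≤-trans (n≤1+n p) (m≤m+n (suc p) d)) fits
      roots-outside : ∀ t → t ≢ t₂ → rootOf t ≤ p ⊎ suc p + d ≤ rootOf t
      roots-outside t _ with root-outside t
      ... | inj₁ h = inj₁ (≤-trans h x≤p)
      ... | inj₂ h = inj₂ (≤-trans (n≤1+n _) h)
      root-at-w : ∀ t → t ≢ t₂ → rootOf t ≡ suc p + d → T₂ ≡ base (suc p + d)
      root-at-w t _ q = ⊥-elim (no-root-at t (s≤s (≤-trans x≤p (m≤m+n p d))) ≤-refl q)
      tooth≢w : ∀ t → t ≢ t₂ → tooth t ≢ T₂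
      tooth≢w t nt q = nt (tooth-inj _ _ q)
      v*∉base : ∀ j → j ≤ len → j ≤ p ⊎ suc (suc p) + d ≤ j → base (suc p + d) ≢ base j
      v*∉base j hj (inj₁ h) = base-≢< (≤-trans (s≤s h) (m≤m+n (suc p) d)) fits
      v*∉base j hj (inj₂ h) = base-≢ fits hj (<⇒≢ h)
      r*-fresh-prefix : ∀ t → t ≢ t₂ → rootOf t ≤ p → suc (suc p) ≢ rootOf t
      r*-fresh-prefix t _ h q = <⇒≢ (≤-trans (s≤s h) (n≤1+n _)) (sym q)
      r*-fresh-suffix : ∀ t → t ≢ t₂ → suc p + d ≤ rootOf t → suc (suc p) + d ≢ rootOf t
      r*-fresh-suffix t nt _ q = nt (rootOf-inj _ _ (trans (sym q) (sym root-t₂)))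

    -- The edge from L₁ skips the root x of t₁; base (x₀ + d), the vertex before its far end,
    -- becomes the new tooth t₁.
    shortcut-L₁ : ∀ d → 1 ≤ d → suc (x₀ + d) < y → A L₁ (base (suc x₀ + d)) ≡ true → Shorter E
    shortcut-L₁ d 1≤d x₀+1+d<y edge = shorten {E = E} record
      { a = x₀ ; d = d ; w = base (suc x₀ + d) ; t* = t₁ ; v* = base (x₀ + d) ; r* = suc x₀ ; 1≤d = 1≤d ; fits = fits
      ; w∉prefix = w∉prefix ; w∉suffix = w∉suffix ; base-a~w = edge ; w~suffix = base-adj (suc x₀ + d)
      ; roots-outside = roots-outside ; root-at-w = λ _ _ _ → refl ; tooth≢w = λ t _ → tooth∉base t fits
      ; v*≢tooth = λ t _ q → tooth∉base t x₀+d≤len (sym q) ; v*∉base = v*∉base ; v*≢w = base-≢ x₀+d≤len fits (<⇒≢ ≤-refl)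
      ; r*≤ = ≤len∸ fits ; r*-fresh-prefix = r*-fresh-prefix ; r*-fresh-suffix = r*-fresh-suffix
      ; v*-adj = inj₂ (inj₁ (refl , base-adj (x₀ + d) fits)) }
      where
      fits : suc x₀ + d ≤ len
      fits = ≤-trans (<⇒≤ x₀+1+d<y) y≤len
      x₀+d≤len : x₀ + d ≤ len
      x₀+d≤len = ≤-trans (n≤1+n _) fits
      x₀<x₀+d : x₀ < x₀ + d
      x₀<x₀+d = subst (_≤ x₀ + d) (+-comm x₀ 1) (+-monoʳ-≤ x₀ 1≤d)
      w∉prefix : ∀ j → j ≤ x₀ → base (suc x₀ + d) ≢ base j
      w∉prefix j h = base-≢< (≤-trans (s≤s h) (m≤m+n (suc x₀) d)) fits
      w∉suffix : ∀ j → suc (suc x₀) + d ≤ j → j ≤ len → base (suc x₀ + d) ≢ base j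
      w∉suffix j h hj = base-≢ fits hj (<⇒≢ h)
      roots-outside : ∀ t → t ≢ t₁ → rootOf t ≤ x₀ ⊎ suc x₀ + d ≤ rootOf t
      roots-outside t nt with root-outside t
      ... | inj₁ h with m≤n⇒m<n∨m≡n h
      ... | inj₁ h' = inj₁ (≤-pred (subst (rootOf t <_) (sym x₀+1≡x) h'))
      ... | inj₂ h' = ⊥-elim (nt (rootOf-inj _ _ (trans h' (sym root-t₁))))
      roots-outside t nt | inj₂ h = inj₂ (≤-trans (<⇒≤ x₀+1+d<y) h)
      v*∉base : ∀ j → j ≤ len → j ≤ x₀ ⊎ suc (suc x₀) + d ≤ j → base (x₀ + d) ≢ base j
      v*∉base j hj (inj₁ h) = base-≢< (≤-trans (s≤s h) x₀<x₀+d) x₀+d≤len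
      v*∉base j hj (inj₂ h) = base-≢ x₀+d≤len hj (<⇒≢ (≤-trans (n≤1+n _) h))
      r*-fresh-prefix : ∀ t → t ≢ t₁ → rootOf t ≤ x₀ → suc x₀ ≢ rootOf t
      r*-fresh-prefix t _ h q = <⇒≢ (s≤s h) (sym q)
      r*-fresh-suffix : ∀ t → t ≢ t₁ → suc x₀ + d ≤ rootOf t → suc x₀ + d ≢ rootOf t
      r*-fresh-suffix t _ _ q = no-root-at t (subst (_< suc x₀ + d) x₀+1≡x (s≤s x₀<x₀+d)) x₀+1+d<y (sym q)

    shortcut-R₁ : ∀ p d → 1 ≤ d → x < p → p + d ≡ y → A R₁ (base p) ≡ true → Shorter E
    shortcut-R₁ p d 1≤d x<p refl edge = shorten {E = E} record
      { a = p ; d = d ; w = R₁ ; t* = t₂ ; v* = base (suc p) ; r* = p ; 1≤d = 1≤d ; fits = y<len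
      ; w∉prefix = w∉prefix ; w∉suffix = w∉suffix ; base-a~w = trans (A-sym _ _) edge ; w~suffix = base-adj (suc (p + d))
      ; roots-outside = roots-outside ; root-at-w = λ _ _ _ → refl ; tooth≢w = λ t _ → tooth∉base t y<len
      ; v*≢tooth = λ t _ q → tooth∉base t p+1≤len (sym q) ; v*∉base = v*∉base
      ; v*≢w = λ q → base-≢< (s≤s (subst (_≤ p + d) (+-comm p 1) (+-monoʳ-≤ p 1≤d))) y<len (sym q)
      ; r*≤ = ≤len∸ y≤len ; r*-fresh-prefix = r*-fresh-prefix ; r*-fresh-suffix = r*-fresh-suffix
      ; v*-adj = inj₁ (≤-refl , trans (A-sym _ _) (base-adj p p+1≤len)) }
      where
      p+1≤len : suc p ≤ len
      p+1≤len = ≤-trans (s≤s (m≤m+n p d)) y<len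
      w∉prefix : ∀ j → j ≤ p → R₁ ≢ base j
      w∉prefix j h = base-≢< (≤-trans (s≤s h) (s≤s (m≤m+n p d))) y<len
      w∉suffix : ∀ j → suc (suc p) + d ≤ j → j ≤ len → R₁ ≢ base j
      w∉suffix j h hj = base-≢ y<len hj (<⇒≢ h)
      roots-outside : ∀ t → t ≢ t₂ → rootOf t ≤ p ⊎ suc p + d ≤ rootOf t
      roots-outside t nt with root-outside t
      ... | inj₁ h = inj₁ (≤-trans h (<⇒≤ x<p))
      ... | inj₂ h with m≤n⇒m<n∨m≡n h
      ... | inj₁ h' = inj₂ h'
      ... | inj₂ h' = ⊥-elim (nt (rootOf-inj _ _ (trans (sym h') (sym root-t₂))))
      v*∉base : ∀ j → j ≤ len → j ≤ p ⊎ suc (suc p) + d ≤ j → base (suc p) ≢ base j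
      v*∉base j hj (inj₁ h) = base-≢< (s≤s h) p+1≤len
      v*∉base j hj (inj₂ h) = base-≢ p+1≤len hj (<⇒≢ (≤-trans (s≤s (s≤s (m≤m+n p d))) h))
      r*-fresh-prefix : ∀ t → t ≢ t₂ → rootOf t ≤ p → p ≢ rootOf t
      r*-fresh-prefix t _ _ q = no-root-at t x<p (subst (_≤ p + d) (+-comm p 1) (+-monoʳ-≤ p 1≤d)) (sym q)
      r*-fresh-suffix : ∀ t → t ≢ t₂ → suc p + d ≤ rootOf t → p + d ≢ rootOf t
      r*-fresh-suffix t _ h = <⇒≢ h


    x₀<x : x₀ < x
    x₀<x = subst (x₀ <_) x₀+1≡x ≤-refl

    x₀≤len : x₀ ≤ len
    x₀≤len = ≤-trans (<⇒≤ x₀<x) x≤len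

    x≤x+2 : x ≤ suc (suc x)
    x≤x+2 = ≤-trans (n≤1+n x) (n≤1+n (suc x))

    y≤y+2 : y ≤ suc (suc y)
    y≤y+2 = ≤-trans (n≤1+n y) (n≤1+n (suc y))

    L₁∉segment : ∀ i → x ≤ i → i ≤ y → L₁ ≢ base i
    L₁∉segment i x≤i i≤y = base-≢ x₀≤len (≤-trans i≤y y≤len) (<⇒≢ (≤-trans x₀<x x≤i))

    R₁∉segment : ∀ i → i ≤ y → R₁ ≢ base i
    R₁∉segment i i≤y = base-≢< (s≤s i≤y) y<len

    L₁~x : A L₁ (base x) ≡ true
    L₁~x = subst (λ z → A L₁ (base z) ≡ true) x₀+1≡x (base-adj x₀ (subst (_≤ len) (sym x₀+1≡x) x≤len))

    R₁~y : A R₁ (base y) ≡ true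
    R₁~y = trans (A-sym _ _) (base-adj y y<len)

    1≤y : 1 ≤ y
    1≤y = ≤-trans 1≤x x≤y

    3≤y : 3 ≤ y
    3≤y = ≤-trans (m≤n+m 3 x) (x+k≤y 3 (≤s+6 (s≤s (s≤s (s≤s z≤n)))))

    ≤pred⇒< : ∀ {p q} → p ≤ pred q → 1 ≤ q → p < q
    ≤pred⇒< {q = suc q} p≤q _ = s≤s p≤q

    neighbourIn : (u : V) (lo hi : ℕ) → (∃ λ p → lo ≤ p × p ≤ hi × A u (base p) ≡ true)
                                      ⊎ (∀ p → lo ≤ p → p ≤ hi → A u (base p) ≡ false)
    neighbourIn u lo hi with search< (suc hi) (λ p → lo ≤ p × A u (base p) ≡ true)
                                               (λ p → (lo ≤? p) D.×-dec (A u (base p) ≟ᵇ true))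
    ... | inj₁ (p , p≤hi , lo≤p , e) = inj₁ (p , lo≤p , ≤-pred p≤hi , e)
    ... | inj₂ none = inj₂ (λ p lo≤p p≤hi → ≢true⇒≡false (λ e → none p (s≤s p≤hi) (lo≤p , e)))

    SegmentInduced : Set
    SegmentInduced = ∀ i j → x ≤ i → i ≤ y → x ≤ j → j ≤ y → A (base i) (base j) ≡ pathAdjℕ i j

    Chordless : Set
    Chordless = ∀ p q → x ≤ p → suc (suc p) ≤ q → q ≤ y → A (base p) (base q) ≡ false

    chordless⇒induced : Chordless → SegmentInduced
    chordless⇒induced chordless i j x≤i i≤y x≤j j≤y with <-cmp i j
    ... | tri< i<j _ _ = forward (m≤n⇒m<n∨m≡n i<j)
      where
      forward : suc i < j ⊎ suc i ≡ j → A (base i) (base j) ≡ pathAdjℕ i j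
      forward (inj₁ far) = trans (chordless i j x≤i far j≤y) (sym (pathAdjℕ-far far))
      forward (inj₂ refl) = trans (base-adj i (≤-trans j≤y y≤len)) (sym (pathAdjℕ-suc i))
    ... | tri≈ _ refl _ = trans (A-irrefl _) (sym (pathAdjℕ-irrefl i))
    ... | tri> _ _ j<i = trans (A-sym _ _) (trans (backward (m≤n⇒m<n∨m≡n j<i)) (pathAdjℕ-sym j i))
      where
      backward : suc j < i ⊎ suc j ≡ i → A (base j) (base i) ≡ pathAdjℕ j i
      backward (inj₁ far) = trans (chordless j i x≤j far i≤y) (sym (pathAdjℕ-far far))
      backward (inj₂ refl) = trans (base-adj j (≤-trans i≤y y≤len)) (sym (pathAdjℕ-suc j))

    HasChord : ℕ → Set
    HasChord p = x ≤ p × ∃ λ q → suc (suc p) ≤ q × q ≤ y × A (base p) (base q) ≡ true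

    hasChord? : ∀ p → Dec (HasChord p)
    hasChord? p with x ≤? p | neighbourIn (base p) (suc (suc p)) y
    ... | no x≰p | _ = no (λ c → x≰p (proj₁ c))
    ... | yes x≤p | inj₁ (q , p+2≤q , q≤y , e) = yes (x≤p , q , p+2≤q , q≤y , e)
    ... | yes x≤p | inj₂ none = no (λ { (_ , q , p+2≤q , q≤y , e) → true≢false (trans (sym e) (none q p+2≤q q≤y)) })
      where
      true≢false : true ≢ false
      true≢false ()

    chordless-or-shorter : Shorter E ⊎ Chordless
    chordless-or-shorter with search< (suc y) HasChord hasChord?
    ... | inj₁ (p , _ , x≤p , q , p+2≤q , q≤y , e) =
      inj₁ (shortcut-chord p (q ∸ suc p) (m<n⇒0<n∸m p+2≤q) x≤p (subst (_≤ y) (sym q≡) q≤y)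
                           (subst (λ z → A (base p) (base z) ≡ true) (sym q≡) e))
      where
      q≡ : suc p + (q ∸ suc p) ≡ q
      q≡ = m+[n∸m]≡n (<⇒≤ p+2≤q)
    ... | inj₂ none = inj₂ λ p q x≤p p+2≤q q≤y → ≢true⇒≡false λ e →
      none p (s≤s (≤-trans (≤-trans (n≤1+n p) (n≤1+n (suc p))) (≤-trans p+2≤q q≤y))) (x≤p , q , p+2≤q , q≤y , e)

    T₁Local : Set
    T₁Local = ∀ i → suc (suc (suc x)) ≤ i → i ≤ y → A T₁ (base i) ≡ false

    T₁Local-or-shorter : Shorter E ⊎ T₁Local
    T₁Local-or-shorter with neighbourIn T₁ (suc (suc (suc x))) y
    ... | inj₁ (p , x+3≤p , p≤y , e) =
      inj₁ (shortcut-T₁ (p ∸ suc (suc x)) (m<n⇒0<n∸m x+3≤p) (subst (_≤ y) (sym p≡) p≤y)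
                        (subst (λ z → A T₁ (base z) ≡ true) (sym p≡) e))
      where
      p≡ : suc (suc x) + (p ∸ suc (suc x)) ≡ p
      p≡ = m+[n∸m]≡n (<⇒≤ x+3≤p)
    ... | inj₂ none = inj₂ none

    T₂Local : Set
    T₂Local = ∀ i → x ≤ i → suc (suc (suc i)) ≤ y → A T₂ (base i) ≡ false

    T₂Local-or-shorter : Shorter E ⊎ T₂Local
    T₂Local-or-shorter with neighbourIn T₂ x (y ∸ 3)
    ... | inj₁ (p , x≤p , p≤y∸3 , e) =
      inj₁ (shortcut-T₂ p (y ∸ suc (suc p)) (m<n⇒0<n∸m p+3≤y) x≤p (m+[n∸m]≡n (<⇒≤ p+3≤y)) e)
      where
      p+3≤y : suc (suc (suc p)) ≤ y
      p+3≤y = subst₂ _≤_ (+-comm p 3) (m∸n+n≡m 3≤y) (+-monoˡ-≤ 3 p≤y∸3)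
    ... | inj₂ none = inj₂ (λ i x≤i i+3≤y → none i x≤i (∸-monoˡ-≤ 3 i+3≤y))

    L₁Local : Set
    L₁Local = ∀ i → x < i → i < y → A L₁ (base i) ≡ false

    L₁Local-or-shorter : Shorter E ⊎ L₁Local
    L₁Local-or-shorter with neighbourIn L₁ (suc x) (pred y)
    ... | inj₁ (p , x<p , p<y , e) =
      inj₁ (shortcut-L₁ (p ∸ x) (m<n⇒0<n∸m x<p) (subst (_< y) (sym p≡) (≤pred⇒< p<y 1≤y))
                        (subst (λ z → A L₁ (base z) ≡ true) (sym p≡) e))
      where
      p≡ : suc x₀ + (p ∸ x) ≡ p
      p≡ = trans (cong (_+ (p ∸ x)) x₀+1≡x) (m+[n∸m]≡n (<⇒≤ x<p))
    ... | inj₂ none = inj₂ (λ i x<i i<y → none i x<i (<⇒≤pred i<y))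

    R₁Local : Set
    R₁Local = ∀ i → x < i → i < y → A R₁ (base i) ≡ false

    R₁Local-or-shorter : Shorter E ⊎ R₁Local
    R₁Local-or-shorter with neighbourIn R₁ (suc x) (pred y)
    ... | inj₁ (p , x<p , p<y , e) =
      inj₁ (shortcut-R₁ p (y ∸ p) (m<n⇒0<n∸m p<y′) x<p (m+[n∸m]≡n (<⇒≤ p<y′)) e)
      where
      p<y′ : p < y
      p<y′ = ≤pred⇒< p<y 1≤y
    ... | inj₂ none = inj₂ (λ i x<i i<y → none i x<i (<⇒≤pred i<y))

    ends-apart : ∀ a c → a ≤ suc (suc x) → y ≤ suc (suc c) → a < c × s + 2 ≤ c ∸ a
    ends-apart a c a≤ y≤ = a<c , +-cancelˡ-≤ a (s + 2) (c ∸ a) (subst (a + (s + 2) ≤_) (sym (m+[n∸m]≡n (<⇒≤ a<c))) apart)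
      where
      eqn : ∀ x s → suc (suc (suc (suc x) + (s + 2))) ≡ x + (s + 6)
      eqn = solve-∀
      apart : a + (s + 2) ≤ c
      apart = ≤-pred (≤-pred (≤-trans (≤-trans (s≤s (s≤s (+-monoˡ-≤ (s + 2) a≤))) (≤-reflexive (eqn x s)))
                                      (≤-trans x+s+6≤y y≤)))
      a<c : a < c
      a<c = ≤-trans (subst (_≤ a + (s + 2)) (+-comm a 1) (+-monoʳ-≤ a (≤-trans (s≤s z≤n) (m≤n+m 2 s)))) apart

    order-bound : ∀ {i} → s + 2 ≤ i → s ≤ suc (suc (suc i))
    order-bound {i} s+2≤i = ≤-trans (m≤m+n s 2) (≤-trans s+2≤i (m≤n+m i 3))

    module Induced (segment-induced : SegmentInduced) where

      segment : ∀ a L → x ≤ a → a + L ≤ y → InducedPath L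
      segment a L x≤a a+L≤y = record
        { vertex = λ j → base (a + j)
        ; vertex-inj = λ i j i≤L j≤L e → +-cancelˡ-≡ a i j (base-inj _ _ (in-base i≤L) (in-base j≤L) e)
        ; vertex-adj = λ i j i≤L j≤L → trans
            (segment-induced (a + i) (a + j) (≤-trans x≤a (m≤m+n a i)) (≤-trans (+-monoʳ-≤ a i≤L) a+L≤y)
                                             (≤-trans x≤a (m≤m+n a j)) (≤-trans (+-monoʳ-≤ a j≤L) a+L≤y))
            (pathAdjℕ-+ˡ a i j) }
        where
        in-base : ∀ {i} → i ≤ L → a + i ≤ len
        in-base i≤L = ≤-trans (≤-trans (+-monoʳ-≤ a i≤L) a+L≤y) y≤len

      base-far : ∀ i j → x ≤ i → suc i < j → j ≤ y → A (base i) (base j) ≡ false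
      base-far i j x≤i i+1<j j≤y =
        trans (segment-induced i j x≤i (≤-trans (≤-trans (n≤1+n i) (<⇒≤ i+1<j)) j≤y)
                               (≤-trans x≤i (≤-trans (n≤1+n i) (≤-trans (n≤1+n (suc i)) i+1<j))) j≤y)
              (pathAdjℕ-far i+1<j)

      hole : ∀ {L} (P : InducedPath L) → 2 ≤ L → s ≤ suc (suc L) → (v : V)
        → (∀ j → j ≤ L → v ≢ vertex P j) → (∀ j → j ≤ L → A v (vertex P j) ≡ ((j ≡ᵇ 0) ∨ (j ≡ᵇ L)))
        → HasCanonicalInduced s G
      hole {L} P 2≤L s≤ v v∉P v-adj = inj₁ (suc (suc L) , s≤s (s≤s 2≤L) , s≤ , CloseHole.hole P v v∉P v-adj)

      hole-through : (v : V) → A v (base x) ≡ true → A v (base y) ≡ true → (∀ i → x < i → i < y → A v (base i) ≡ false)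
        → (∀ i → x ≤ i → i ≤ y → v ≢ base i) → HasCanonicalInduced s G
      hole-through v v~x v~y v≁inner v∉ = hole P 2≤L s≤ v
          (λ j j≤L → v∉ (x + j) (m≤m+n x j) (≤-trans (+-monoʳ-≤ x j≤L) (≤-reflexive x+L≡y)))
          (only-at-ends L (λ j → A v (base (x + j)))
             (subst (λ z → A v (base z) ≡ true) (sym (+-identityʳ x)) v~x)
             (subst (λ z → A v (base z) ≡ true) (sym x+L≡y) v~y)
             (λ j 1≤j j<L → v≁inner (x + j) (subst (_≤ x + j) (+-comm x 1) (+-monoʳ-≤ x 1≤j)) (subst (x + j <_) x+L≡y (+-monoʳ-< x j<L))))
        where
        L = y ∸ x
        x+L≡y : x + L ≡ y
        x+L≡y = m+[n∸m]≡n x≤y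
        P = segment x L ≤-refl (≤-reflexive x+L≡y)
        2≤L : 2 ≤ L
        2≤L = +-cancelˡ-≤ x 2 L (subst (x + 2 ≤_) (sym x+L≡y) (x+k≤y 2 (≤s+6 (s≤s (s≤s z≤n)))))
        s≤ : s ≤ suc (suc L)
        s≤ = ≤-trans (m≤m+n s 6) (≤-trans (+-cancelˡ-≤ x (s + 6) L (subst (x + (s + 6) ≤_) (sym x+L≡y) x+s+6≤y))
                                          (≤-trans (n≤1+n L) (n≤1+n (suc L))))

      -- the hole u, base a, …, base c, v
      hole-around : ∀ (u v : V) a c → x ≤ a → a < c → c ≤ y → s ≤ suc (suc (suc (c ∸ a)))
        → A u (base a) ≡ true → (∀ i → a < i → i ≤ c → A u (base i) ≡ false)
        → A v u ≡ true → A v (base c) ≡ true → (∀ i → a ≤ i → i < c → A v (base i) ≡ false)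
        → (∀ i → a ≤ i → i ≤ c → u ≢ base i) → (∀ i → a ≤ i → i ≤ c → v ≢ base i) → v ≢ u
        → HasCanonicalInduced s G
      hole-around u v a c x≤a a<c c≤y s≤ u~a u≁rest v~u v~c v≁rest u∉ v∉ v≢u =
        hole P′ (s≤s (m<n⇒0<n∸m a<c)) s≤ v v∉P′ v-adj
        where
        L = c ∸ a
        a+L≡c : a + L ≡ c
        a+L≡c = m+[n∸m]≡n (<⇒≤ a<c)
        a+j≤c : ∀ {j} → j ≤ L → a + j ≤ c
        a+j≤c j≤L = ≤-trans (+-monoʳ-≤ a j≤L) (≤-reflexive a+L≡c)
        P′ = prepend (segment a L x≤a (subst (_≤ y) (sym a+L≡c) c≤y)) u
          (λ j j≤L → u∉ (a + j) (m≤m+n a j) (a+j≤c j≤L))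
          (only-at-first L (λ j → A u (base (a + j))) (subst (λ z → A u (base z) ≡ true) (sym (+-identityʳ a)) u~a)
             (λ j 1≤j j≤L → u≁rest (a + j) (subst (_≤ a + j) (+-comm a 1) (+-monoʳ-≤ a 1≤j)) (a+j≤c j≤L)))
        v∉P′ : ∀ j → j ≤ suc L → v ≢ vertex P′ j
        v∉P′ zero    _ = v≢u
        v∉P′ (suc j) (s≤s j≤L) = v∉ (a + j) (m≤m+n a j) (a+j≤c j≤L)
        f : ℕ → Bool
        f zero    = A v u
        f (suc j) = A v (base (a + j))
        v-adj : ∀ j → j ≤ suc L → A v (vertex P′ j) ≡ ((j ≡ᵇ 0) ∨ (j ≡ᵇ suc L))
        v-adj zero    _ = v~u
        v-adj (suc j) j≤ = only-at-ends (suc L) f v~u (subst (λ z → A v (base z) ≡ true) (sym a+L≡c) v~c)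
           (λ { (suc j′) _ (s≤s j′<L) → v≁rest (a + j′) (m≤m+n a j′) (subst (a + j′ <_) a+L≡c (+-monoʳ-< a j′<L)) }) (suc j) j≤

    module Clean (segment-induced : SegmentInduced) (T₁-local : T₁Local) (T₂-local : T₂Local)
                 (L₁-local : L₁Local) (R₁-local : R₁Local)
                 (L₁≁y : A L₁ (base y) ≡ false) (R₁≁x : A R₁ (base x) ≡ false) where
      open Induced segment-induced

      L₁≁after-x : ∀ i → x < i → i ≤ y → A L₁ (base i) ≡ false
      L₁≁after-x i x<i i≤y with m≤n⇒m<n∨m≡n i≤y
      ... | inj₁ i<y = L₁-local i x<i i<y
      ... | inj₂ refl = L₁≁y

      R₁≁before-y : ∀ i → x ≤ i → i < y → A R₁ (base i) ≡ false
      R₁≁before-y i x≤i i<y with m≤n⇒m<n∨m≡n x≤i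
      ... | inj₁ x<i = R₁-local i x<i i<y
      ... | inj₂ refl = R₁≁x

      x+3≤y : suc (suc (suc x)) ≤ y
      x+3≤y = subst (_≤ y) (+-comm x 3) (x+k≤y 3 (≤s+6 (s≤s (s≤s (s≤s z≤n)))))

      -- base a is the last neighbour of T₁ on the segment; Pₗ is a second pendant at base a,
      -- namely its predecessor on the base, or L₁ when a = x.
      record LeftEnd : Set where
        field
          a iₗ  : ℕ
          Pₗ    : V
          x≤a   : x ≤ a
          a≤x+2 : a ≤ suc (suc x)
          Pₗ≡   : Pₗ ≡ base iₗ
          iₗ<a  : iₗ < a
          T₁~a  : A T₁ (base a) ≡ true
          T₁≁after : ∀ i → a < i → i ≤ y → A T₁ (base i) ≡ false
          Pₗ~a  : A Pₗ (base a) ≡ true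
          Pₗ≁after : ∀ i → a < i → i ≤ y → A Pₗ (base i) ≡ false
          Pₗ-cases : Pₗ ≡ L₁ ⊎ x ≤ iₗ

      leftEnd : LeftEnd
      leftEnd with A T₁ (base (suc (suc x))) in T₁~x+2
      ... | true = record
        { a = suc (suc x) ; Pₗ = base (suc x) ; iₗ = suc x ; x≤a = x≤x+2 ; a≤x+2 = ≤-refl
        ; Pₗ≡ = refl ; iₗ<a = ≤-refl ; T₁~a = T₁~x+2 ; T₁≁after = T₁-local
        ; Pₗ~a = base-adj (suc x) (≤-trans (≤-trans (n≤1+n (suc (suc x))) x+3≤y) y≤len)
        ; Pₗ≁after = λ i → base-far (suc x) i (n≤1+n x) ; Pₗ-cases = inj₂ (n≤1+n x) }
      ... | false with A T₁ (base (suc x)) in T₁~x+1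
      ...   | true = record
        { a = suc x ; Pₗ = base x ; iₗ = x ; x≤a = n≤1+n x ; a≤x+2 = n≤1+n (suc x)
        ; Pₗ≡ = refl ; iₗ<a = ≤-refl ; T₁~a = T₁~x+1 ; T₁≁after = T₁≁after
        ; Pₗ~a = base-adj x (≤-trans (≤-trans (n≤1+n (suc x)) (n≤1+n (suc (suc x)))) (≤-trans x+3≤y y≤len))
        ; Pₗ≁after = λ i → base-far x i ≤-refl ; Pₗ-cases = inj₂ ≤-refl }
        where
        T₁≁after : ∀ i → suc x < i → i ≤ y → A T₁ (base i) ≡ false
        T₁≁after i x+1<i i≤y with m≤n⇒m<n∨m≡n x+1<i
        ... | inj₂ refl = T₁~x+2
        ... | inj₁ x+2<i = T₁-local i x+2<i i≤y
      ...   | false = record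
        { a = x ; Pₗ = L₁ ; iₗ = x₀ ; x≤a = ≤-refl ; a≤x+2 = x≤x+2
        ; Pₗ≡ = refl ; iₗ<a = subst (x₀ <_) x₀+1≡x ≤-refl ; T₁~a = T₁~x ; T₁≁after = T₁≁after
        ; Pₗ~a = L₁~x ; Pₗ≁after = L₁≁after-x ; Pₗ-cases = inj₁ refl }
        where
        T₁≁after : ∀ i → x < i → i ≤ y → A T₁ (base i) ≡ false
        T₁≁after i x<i i≤y with m≤n⇒m<n∨m≡n x<i
        ... | inj₂ refl = T₁~x+1
        ... | inj₁ x+1<i with m≤n⇒m<n∨m≡n x+1<i
        ...   | inj₂ refl = T₁~x+2
        ...   | inj₁ x+2<i = T₁-local i x+2<i i≤y

      -- Mirror image of LeftEnd: base c is the first neighbour of T₂ on the segment.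
      record RightEnd : Set where
        field
          c iᵣ  : ℕ
          Pᵣ    : V
          c≤y   : c ≤ y
          y≤c+2 : y ≤ suc (suc c)
          Pᵣ≡   : Pᵣ ≡ base iᵣ
          c<iᵣ  : c < iᵣ
          iᵣ≤y+1 : iᵣ ≤ suc y
          T₂~c  : A T₂ (base c) ≡ true
          T₂≁before : ∀ i → x ≤ i → i < c → A T₂ (base i) ≡ false
          Pᵣ~c  : A Pᵣ (base c) ≡ true
          Pᵣ≁before : ∀ i → x ≤ i → i < c → A Pᵣ (base i) ≡ false
          Pᵣ-cases : Pᵣ ≡ R₁ ⊎ iᵣ ≤ y

      rightEnd : RightEnd
      rightEnd = from (pred (pred y)) (y≡ x+3≤y)
        where
        y≡ : ∀ {n m} → suc (suc m) ≤ n → suc (suc (pred (pred n))) ≡ n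
        y≡ (s≤s (s≤s _)) = refl
        from : ∀ z → suc (suc z) ≡ y → RightEnd
        from z refl with A T₂ (base z) in T₂~z
        ... | true = record
          { c = z ; Pᵣ = base (suc z) ; iᵣ = suc z ; c≤y = ≤-trans (n≤1+n z) (n≤1+n (suc z)) ; y≤c+2 = ≤-refl
          ; Pᵣ≡ = refl ; c<iᵣ = ≤-refl ; iᵣ≤y+1 = ≤-trans (n≤1+n (suc z)) (n≤1+n (suc (suc z))) ; T₂~c = T₂~z
          ; T₂≁before = λ i x≤i i<z → T₂-local i x≤i (s≤s (s≤s i<z))
          ; Pᵣ~c = trans (A-sym _ _) (base-adj z (≤-trans (n≤1+n (suc z)) (≤-trans (n≤1+n (suc (suc z))) y<len)))
          ; Pᵣ≁before = λ i x≤i i<z → trans (A-sym _ _) (base-far i (suc z) x≤i (s≤s i<z) (n≤1+n (suc z))) ; Pᵣ-cases = inj₂ (n≤1+n (suc z)) }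
        ... | false with A T₂ (base (suc z)) in T₂~z+1
        ...   | true = record
          { c = suc z ; Pᵣ = base (suc (suc z)) ; iᵣ = suc (suc z) ; c≤y = n≤1+n (suc z) ; y≤c+2 = n≤1+n (suc (suc z))
          ; Pᵣ≡ = refl ; c<iᵣ = ≤-refl ; iᵣ≤y+1 = n≤1+n (suc (suc z)) ; T₂~c = T₂~z+1 ; T₂≁before = T₂≁before
          ; Pᵣ~c = trans (A-sym _ _) (base-adj (suc z) (≤-trans (n≤1+n (suc (suc z))) y<len))
          ; Pᵣ≁before = λ i x≤i i<z+1 → trans (A-sym _ _) (base-far i (suc (suc z)) x≤i (s≤s i<z+1) ≤-refl) ; Pᵣ-cases = inj₂ ≤-refl }
          where
          T₂≁before : ∀ i → x ≤ i → i < suc z → A T₂ (base i) ≡ false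
          T₂≁before i x≤i i<z+1 with m≤n⇒m<n∨m≡n (≤-pred i<z+1)
          ... | inj₂ refl = T₂~z
          ... | inj₁ i<z = T₂-local i x≤i (s≤s (s≤s i<z))
        ...   | false = record
          { c = suc (suc z) ; Pᵣ = R₁ ; iᵣ = suc (suc (suc z)) ; c≤y = ≤-refl ; y≤c+2 = ≤-trans (n≤1+n _) (n≤1+n _)
          ; Pᵣ≡ = refl ; c<iᵣ = ≤-refl ; iᵣ≤y+1 = ≤-refl ; T₂~c = T₂~y ; T₂≁before = T₂≁before
          ; Pᵣ~c = R₁~y ; Pᵣ≁before = R₁≁before-y ; Pᵣ-cases = inj₁ refl }
          where
          T₂≁before : ∀ i → x ≤ i → i < suc (suc z) → A T₂ (base i) ≡ false
          T₂≁before i x≤i i<z+2 with m≤n⇒m<n∨m≡n (≤-pred i<z+2)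
          ... | inj₂ refl = T₂~z+1
          ... | inj₁ i<z+1 with m≤n⇒m<n∨m≡n (≤-pred i<z+1)
          ...   | inj₂ refl = T₂~z
          ...   | inj₁ i<z = T₂-local i x≤i (s≤s (s≤s i<z))

      module Final (l : LeftEnd) (r : RightEnd) where
        open LeftEnd l
        open RightEnd r

        a<c : a < c
        a<c = proj₁ (ends-apart a c a≤x+2 y≤c+2)

        s≤order : s ≤ suc (c ∸ a)
        s≤order = ≤-trans (m≤m+n s 2) (≤-trans (proj₂ (ends-apart a c a≤x+2 y≤c+2)) (n≤1+n (c ∸ a)))

        c≤len : c ≤ len
        c≤len = ≤-trans c≤y y≤len

        span : ℕ
        span = c ∸ a

        a+span≡c : a + span ≡ c
        a+span≡c = m+[n∸m]≡n (<⇒≤ a<c)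

        a+j≤c : ∀ {j} → j ≤ span → a + j ≤ c
        a+j≤c j≤span = ≤-trans (+-monoʳ-≤ a j≤span) (≤-reflexive a+span≡c)

        a<a+j : ∀ {j} → 1 ≤ j → a < a + j
        a<a+j {j} 1≤j = subst (_≤ a + j) (+-comm a 1) (+-monoʳ-≤ a 1≤j)

        a+j<c : ∀ {j} → j < span → a + j < c
        a+j<c j<span = subst (_ <_) a+span≡c (+-monoʳ-< a j<span)

        iₗ≤len : iₗ ≤ len
        iₗ≤len = ≤-trans (<⇒≤ (<-trans iₗ<a a<c)) c≤len

        iᵣ≤len : iᵣ ≤ len
        iᵣ≤len = ≤-trans iᵣ≤y+1 y<len

        T₁≁Pᵣ : A T₁ R₁ ≡ false → A T₁ Pᵣ ≡ false
        T₁≁Pᵣ T₁≁R₁ with Pᵣ-cases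
        ... | inj₁ Pᵣ≡R₁ = subst (λ z → A T₁ z ≡ false) (sym Pᵣ≡R₁) T₁≁R₁
        ... | inj₂ iᵣ≤y = subst (λ z → A T₁ z ≡ false) (sym Pᵣ≡) (T₁≁after iᵣ (<-trans a<c c<iᵣ) iᵣ≤y)

        Pₗ≁T₂ : A L₁ T₂ ≡ false → A Pₗ T₂ ≡ false
        Pₗ≁T₂ L₁≁T₂ with Pₗ-cases
        ... | inj₁ Pₗ≡L₁ = subst (λ z → A z T₂ ≡ false) (sym Pₗ≡L₁) L₁≁T₂
        ... | inj₂ x≤iₗ = subst (λ z → A z T₂ ≡ false) (sym Pₗ≡)
                                (trans (A-sym _ _) (T₂≁before iₗ x≤iₗ (<-trans iₗ<a a<c)))

        Pₗ≁Pᵣ : A L₁ R₁ ≡ false → A Pₗ Pᵣ ≡ false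
        Pₗ≁Pᵣ L₁≁R₁ with Pᵣ-cases | Pₗ-cases
        ... | inj₂ iᵣ≤y | _ = subst (λ z → A Pₗ z ≡ false) (sym Pᵣ≡) (Pₗ≁after iᵣ (<-trans a<c c<iᵣ) iᵣ≤y)
        ... | inj₁ _ | inj₂ x≤iₗ =
          trans (A-sym _ _) (subst (λ z → A Pᵣ z ≡ false) (sym Pₗ≡) (Pᵣ≁before iₗ x≤iₗ (<-trans iₗ<a a<c)))
        ... | inj₁ Pᵣ≡R₁ | inj₁ Pₗ≡L₁ = subst₂ (λ u w → A u w ≡ false) (sym Pₗ≡L₁) (sym Pᵣ≡R₁) L₁≁R₁

        frame : A T₁ T₂ ≡ false → A T₁ R₁ ≡ false → A L₁ T₂ ≡ false → A L₁ R₁ ≡ false → HFrame span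
        frame T₁≁T₂ T₁≁R₁ L₁≁T₂ L₁≁R₁ = record
          { body = segment a span x≤a (subst (_≤ y) (sym a+span≡c) c≤y) ; a₁ = T₁ ; a₂ = Pₗ ; b₁ = T₂ ; b₂ = Pᵣ
          ; a₁-body = only-at-first span (λ j → A T₁ (base (a + j)))
                        (subst (λ z → A T₁ (base z) ≡ true) (sym (+-identityʳ a)) T₁~a)
                        (λ j 1≤j j≤span → T₁≁after (a + j) (a<a+j 1≤j) (≤-trans (a+j≤c j≤span) c≤y))
          ; a₂-body = only-at-first span (λ j → A Pₗ (base (a + j)))
                        (subst (λ z → A Pₗ (base z) ≡ true) (sym (+-identityʳ a)) Pₗ~a)
                        (λ j 1≤j j≤span → Pₗ≁after (a + j) (a<a+j 1≤j) (≤-trans (a+j≤c j≤span) c≤y))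
          ; b₁-body = only-at-last span (λ j → A T₂ (base (a + j))) (subst (λ z → A T₂ (base z) ≡ true) (sym a+span≡c) T₂~c)
                        (λ j j<span → T₂≁before (a + j) (≤-trans x≤a (m≤m+n a j)) (a+j<c j<span))
          ; b₂-body = only-at-last span (λ j → A Pᵣ (base (a + j))) (subst (λ z → A Pᵣ (base z) ≡ true) (sym a+span≡c) Pᵣ~c)
                        (λ j j<span → Pᵣ≁before (a + j) (≤-trans x≤a (m≤m+n a j)) (a+j<c j<span))
          ; a₁≁b₁ = T₁≁T₂ ; a₁≁b₂ = T₁≁Pᵣ T₁≁R₁ ; a₂≁b₁ = Pₗ≁T₂ L₁≁T₂ ; a₂≁b₂ = Pₗ≁Pᵣ L₁≁R₁
          ; a₁≢a₂ = λ q → tooth∉base t₁ iₗ≤len (trans q Pₗ≡)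
          ; b₁≢b₂ = λ q → tooth∉base t₂ iᵣ≤len (trans q Pᵣ≡)
          ; a₁≢b₁ = λ q → t₁≢t₂ (tooth-inj _ _ q)
          ; a₁≢b₂ = λ q → tooth∉base t₁ iᵣ≤len (trans q Pᵣ≡)
          ; a₂≢b₁ = λ q → tooth∉base t₂ iₗ≤len (trans (sym q) Pₗ≡)
          ; a₂≢b₂ = λ q → base-≢ iₗ≤len iᵣ≤len (<⇒≢ (<-trans iₗ<a (<-trans a<c c<iᵣ))) (trans (sym Pₗ≡) (trans q Pᵣ≡))
          ; a₁∉body = λ j j≤span → tooth∉base t₁ (≤-trans (a+j≤c j≤span) c≤len)
          ; a₂∉body = λ j j≤span q → base-≢ iₗ≤len (≤-trans (a+j≤c j≤span) c≤len)
                                       (<⇒≢ (≤-trans iₗ<a (m≤m+n a j))) (trans (sym Pₗ≡) q)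
          ; b₁∉body = λ j j≤span → tooth∉base t₂ (≤-trans (a+j≤c j≤span) c≤len)
          ; b₂∉body = λ j j≤span q → base-≢ iᵣ≤len (≤-trans (a+j≤c j≤span) c≤len)
                                       (λ q′ → <⇒≢ (≤-trans (s≤s (a+j≤c j≤span)) c<iᵣ) (sym q′)) (trans (sym Pᵣ≡) q) }

        -- An edge between a left pendant (T₁ or L₁) and a right pendant (T₂ or R₁) closes a hole;
        -- without such an edge the two ends form an H-graph.
        canonical : HasCanonicalInduced s G
        canonical with A T₁ T₂ in T₁~T₂
        ... | true = hole-around T₁ T₂ a c x≤a a<c c≤y (order-bound (proj₂ (ends-apart a c a≤x+2 y≤c+2)))
               T₁~a (λ i a<i i≤c → T₁≁after i a<i (≤-trans i≤c c≤y))
               (trans (A-sym _ _) T₁~T₂) T₂~c (λ i a≤i i<c → T₂≁before i (≤-trans x≤a a≤i) i<c)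
               (λ i _ i≤c → tooth∉base t₁ (≤-trans i≤c c≤len)) (λ i _ i≤c → tooth∉base t₂ (≤-trans i≤c c≤len))
               (λ q → t₁≢t₂ (sym (tooth-inj _ _ q)))
        ... | false with A T₁ R₁ in T₁~R₁
        ...   | true = hole-around T₁ R₁ a y x≤a (proj₁ (ends-apart a y a≤x+2 y≤y+2)) ≤-refl
               (order-bound (proj₂ (ends-apart a y a≤x+2 y≤y+2))) T₁~a T₁≁after
               (trans (A-sym _ _) T₁~R₁) R₁~y (λ i a≤i i<y → R₁≁before-y i (≤-trans x≤a a≤i) i<y)
               (λ i _ i≤y → tooth∉base t₁ (≤-trans i≤y y≤len)) (λ i _ i≤y → R₁∉segment i i≤y)
               (λ q → tooth∉base t₁ y<len (sym q))
        ...   | false with A L₁ T₂ in L₁~T₂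
        ...     | true = hole-around L₁ T₂ x c ≤-refl (proj₁ (ends-apart x c x≤x+2 y≤c+2)) c≤y
               (order-bound (proj₂ (ends-apart x c x≤x+2 y≤c+2))) L₁~x (λ i x<i i≤c → L₁≁after-x i x<i (≤-trans i≤c c≤y))
               (trans (A-sym _ _) L₁~T₂) T₂~c T₂≁before
               (λ i x≤i i≤c → L₁∉segment i x≤i (≤-trans i≤c c≤y)) (λ i _ i≤c → tooth∉base t₂ (≤-trans i≤c c≤len))
               (tooth∉base t₂ x₀≤len)
        ...     | false with A L₁ R₁ in L₁~R₁
        ...       | true = hole-around L₁ R₁ x y ≤-refl (proj₁ (ends-apart x y x≤x+2 y≤y+2)) ≤-refl
               (order-bound (proj₂ (ends-apart x y x≤x+2 y≤y+2))) L₁~x L₁≁after-x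
               (trans (A-sym _ _) L₁~R₁) R₁~y R₁≁before-y
               L₁∉segment (λ i _ i≤y → R₁∉segment i i≤y) (R₁∉segment x₀ (≤-trans (<⇒≤ x₀<x) x≤y))
        ...       | false = inj₂ (proj₁ H , span , m<n⇒0<n∸m a<c , s≤order , proj₂ H)
          where
          H = HFrame⇒induced (frame T₁~T₂ T₁~R₁ L₁~T₂ L₁~R₁)

      canonical : HasCanonicalInduced s G
      canonical = Final.canonical leftEnd rightEnd

    clean⇒canonical : SegmentInduced → T₁Local → T₂Local → L₁Local → R₁Local → HasCanonicalInduced s G
    clean⇒canonical induced T₁-local T₂-local L₁-local R₁-local with A L₁ (base y) in L₁~y
    ... | true = Induced.hole-through induced L₁ L₁~x L₁~y L₁-local L₁∉segment
    ... | false with A R₁ (base x) in R₁~x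
    ...   | true = Induced.hole-through induced R₁ R₁~x R₁~y R₁-local (λ i _ → R₁∉segment i)
    ...   | false = Clean.canonical induced T₁-local T₂-local L₁-local R₁-local L₁~y R₁~x

    canonical-or-shorter : HasCanonicalInduced s G ⊎ Shorter E
    canonical-or-shorter with chordless-or-shorter
    ... | inj₁ shorter = inj₂ shorter
    ... | inj₂ chordless with T₁Local-or-shorter
    ...   | inj₁ shorter = inj₂ shorter
    ...   | inj₂ T₁-local with T₂Local-or-shorter
    ...     | inj₁ shorter = inj₂ shorter
    ...     | inj₂ T₂-local with L₁Local-or-shorter
    ...       | inj₁ shorter = inj₂ shorter
    ...       | inj₂ L₁-local with R₁Local-or-shorter
    ...         | inj₁ shorter = inj₂ shorter
    ...         | inj₂ R₁-local = inj₁ (clean⇒canonical (chordless⇒induced chordless) T₁-local T₂-local L₁-local R₁-local)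

  denseRake-or-canonical : ∀ k s (E : EmbeddedRake (suc (suc k))) → Acc _<_ (EmbeddedRake.len E)
    → (∃ λ (R : Rake k) → Dense (s + 5) R × SubgraphOf (rakeAdj R) G) ⊎ HasCanonicalInduced s G
  denseRake-or-canonical k s E (acc smaller) with denseOrGap k (s + 5) (≤-trans (s≤s (s≤s z≤n)) (m≤n+m 5 s)) E
  ... | inj₁ (E′ , dense) = inj₁ (ToRake.rake E′ , ToRake.dense E′ (s + 5) dense , ToRake.subgraph E′)
  ... | inj₂ gap with GapAnalysis.canonical-or-shorter s E gap
  ...   | inj₁ canonical = inj₂ canonical
  ...   | inj₂ (E′ , shorter) = denseRake-or-canonical k s E′ (smaller shorter)

  reindex : ∀ {K K′} → K ≡ K′ → EmbeddedRake K → EmbeddedRake K′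
  reindex {K} {K′} K≡K′ E = restrict E (F.cast (sym K≡K′)) cast-inj 0 len z≤n ≤-refl (λ u → z≤n , rootOf≤len _)
    where
    open EmbeddedRake E
    cast-inj : ∀ s t → F.cast (sym K≡K′) s ≡ F.cast (sym K≡K′) t → s ≡ t
    cast-inj s t q = FP.toℕ-injective (trans (sym (FP.toℕ-cast (sym K≡K′) s)) (trans (cong toℕ q) (FP.toℕ-cast (sym K≡K′) t)))

lemma4 : (k s : ℕ) (G : Graph) →
    (∃ λ (R : Rake (k + 2)) → SubgraphOf (rakeAdj R) G) →
    (∃ λ (R : Rake k) → Dense (s + 5) R × SubgraphOf (rakeAdj R) G)
      ⊎ HasCanonicalInduced s G
lemma4 k s G (R , R⊆G) = denseRake-or-canonical G k s E (<-wellFounded (EmbeddedRake.len E))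
  where
  E : EmbeddedRake G (suc (suc k))
  E = reindex G (+-comm k 2) (fromSubgraph G R R⊆G)
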